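{- For every positive integer $n$ and every $d\ge0$, the partial F-paths of length $n$ having $d$ squares or half-squares are in bijection with the $d$-dimensional cubes of the state complex of $SR_n$.
   Context: A partial NE-path is a sequence of links, each a north edge $N$, an east edge $E$, a unit square $\square$, or a partial unit square $\llcorner$, placed consecutively from $(0,0)$, where each square is attached by its southwest and northeast corners and there is at most one partial square, which must be the last link, attached by its southwest corner; its length is $e+2f+g$ ($e$ edges, $f$ squares, $g\in\{0,1\}$ half-squares). A partial F-path is a partial NE-path in which the link following any $N$ or $\square$, if there is one, is an $E$. The robotic arm $SR_n$: $n$ unit links in the strip $[0,n]\times[0,1]$, base at $(0,0)$, each facing north, south or east, never revisiting a point; states correspond to spread-out subsets $A\subseteq[n]$ (indices of vertical links; no two consecutive). Moves: corner switch at $i$ ($1\le i\le n-1$): links $i,i+1$ facing different directions interchange directions if the result is valid (changes links $\{i,i+1\}$, involves links $\{i-1,i,i+1,i+2\}\cap[n]$); end flip: last link rotates $90^\circ$ between horizontal and vertical if the result is valid (changes $\{n\}$, involves $\{n-1,n\}\cap[n]$). Two moves commute if the links changed by each are disjoint from the links involved in the other. The state complex of $SR_n$ has the states as vertices and, for each state $u$ and each set of $d$ pairwise commuting moves applicable at $u$, a $d$-cube with vertices the $2^d$ states obtained by applying subsets of these moves to $u$. -}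

module Defs where

open import Level using (0ℓ)
open import Data.Nat using (ℕ; zero; suc; _+_; _∸_; _≤_; _<_; _≤?_)
open import Data.Integer as ℤ using (ℤ; +_; -[1+_])
open import Data.Product using (Σ; _×_; _,_; proj₁; proj₂)
open import Relation.Nullary.Decidable using (_×-dec_; Dec)
open import Data.Nat.ListAction using (sum)
open import Data.List using (List; []; _∷_; length; map; filter; _++_)
open import Data.List.Relation.Unary.All using (All)
open import Data.List.Relation.Unary.AllPairs using (AllPairs)
open import Data.List.Relation.Unary.Unique.Propositional using (Unique)
open import Data.List.Membership.Propositional using (_∈_)
open import Data.Maybe using (Maybe; just; nothing)
open import Data.Unit using (⊤)
open import Data.Empty using (⊥)
open import Relation.Nullary using (¬_)
open import Relation.Binary using (Setoid; IsEquivalence)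
open import Relation.Binary.PropositionalEquality using (_≡_; _≢_; refl; sym; trans)

-- links: north edge, east edge, unit square, partial (half) square
data Link : Set where
  lN lE lSq lHalf : Link

IsPartialNE : List Link → Set
IsPartialNE []                  = ⊤
IsPartialNE (lHalf ∷ [])        = ⊤
IsPartialNE (lHalf ∷ _ ∷ _)     = ⊥
IsPartialNE (lN ∷ r)            = IsPartialNE r
IsPartialNE (lE ∷ r)            = IsPartialNE r
IsPartialNE (lSq ∷ r)           = IsPartialNE r

FollowOK : Link → List Link → Set
FollowOK lN  []      = ⊤
FollowOK lN  (y ∷ _) = y ≡ lE
FollowOK lSq []      = ⊤
FollowOK lSq (y ∷ _) = y ≡ lE
FollowOK lE    _     = ⊤
FollowOK lHalf _     = ⊤

FCond : List Link → Set
FCond []      = ⊤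
FCond (x ∷ r) = FollowOK x r × FCond r

IsPartialFPath : List Link → Set
IsPartialFPath p = IsPartialNE p × FCond p

linkLen : Link → ℕ
linkLen lN    = 1
linkLen lE    = 1
linkLen lSq   = 2
linkLen lHalf = 1

pathLength : List Link → ℕ
pathLength p = sum (map linkLen p)

isSquareish : Link → ℕ
isSquareish lN    = 0
isSquareish lE    = 0
isSquareish lSq   = 1
isSquareish lHalf = 1

squareCount : List Link → ℕ
squareCount p = sum (map isSquareish p)

FPath : ℕ → ℕ → Set
FPath n d = Σ (List Link) λ p → IsPartialFPath p × pathLength p ≡ n × squareCount p ≡ d

FPathSetoid : ℕ → ℕ → Setoid 0ℓ 0ℓ
FPathSetoid n d = record
  { Carrier = FPath n d
  ; _≈_ = λ p q → proj₁ p ≡ proj₁ q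
  ; isEquivalence = record { refl = refl ; sym = sym ; trans = trans }
  }

data Dir : Set where
  nor sou eas : Dir

stepPt : ℕ × ℤ → Dir → ℕ × ℤ
stepPt (x , y) nor = (x , y ℤ.+ ℤ.1ℤ)
stepPt (x , y) sou = (x , y ℤ.- ℤ.1ℤ)
stepPt (x , y) eas = (suc x , y)

pointsFrom : ℕ × ℤ → List Dir → List (ℕ × ℤ)
pointsFrom p []      = p ∷ []
pointsFrom p (l ∷ w) = p ∷ pointsFrom (stepPt p l) w

points : List Dir → List (ℕ × ℤ)
points = pointsFrom (0 , ℤ.0ℤ)

InStrip : ℕ × ℤ → Set
InStrip (x , y) = ℤ.0ℤ ℤ.≤ y × y ℤ.≤ ℤ.1ℤ

-- valid configuration: stays in the strip [0,n]×[0,1] (the x-bound is automatic,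
-- as there are n links), and never revisits a point
Valid : List Dir → Set
Valid w = All InStrip (points w) × Unique (points w)

State : ℕ → Set
State n = Σ (List Dir) λ w → length w ≡ n × Valid w

-- moves: corner switch at i (1-indexed), and end flip
data Move : Set where
  switch : ℕ → Move
  flip   : Move

linkAt : ℕ → List Dir → Maybe Dir
linkAt _             []      = nothing
linkAt zero          (_ ∷ _) = nothing
linkAt (suc zero)    (l ∷ _) = just l
linkAt (suc (suc i)) (_ ∷ w) = linkAt (suc i) w

swapAt : ℕ → List Dir → List Dir
swapAt zero          w           = w
swapAt (suc zero)    (x ∷ y ∷ r) = y ∷ x ∷ r
swapAt (suc zero)    w           = w
swapAt (suc (suc i)) []          = []
swapAt (suc (suc i)) (x ∷ r)     = x ∷ swapAt (suc i) r

-- rotate a link by 90° between horizontal and vertical; when turning an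
-- east link vertical, the height h of its starting point determines the
-- only direction that can stay in the strip (north at height 0, south otherwise)
rotate : ℤ → Dir → Dir
rotate _ nor            = eas
rotate _ sou            = eas
rotate (+ zero) eas     = nor
rotate (+ suc _) eas    = sou
rotate -[1+ _ ] eas     = sou

stepH : ℤ → Dir → ℤ
stepH h nor = h ℤ.+ ℤ.1ℤ
stepH h sou = h ℤ.- ℤ.1ℤ
stepH h eas = h

flipFrom : ℤ → List Dir → List Dir
flipFrom h []          = []
flipFrom h (x ∷ [])    = rotate h x ∷ []
flipFrom h (x ∷ y ∷ r) = x ∷ flipFrom (stepH h x) (y ∷ r)

flipLast : List Dir → List Dir
flipLast = flipFrom ℤ.0ℤ

applyMove : Move → List Dir → List Dir
applyMove (switch i) = swapAt i
applyMove flip       = flipLast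

Applicable : ℕ → Move → List Dir → Set
Applicable n (switch i) w =
  1 ≤ i × i < n × linkAt i w ≢ linkAt (suc i) w × Valid (swapAt i w)
Applicable n flip w = Valid (flipLast w)

inRange? : (n k : ℕ) → Dec (1 ≤ k × k ≤ n)
inRange? n k = (1 ≤? k) ×-dec (k ≤? n)

changed : ℕ → Move → List ℕ
changed n (switch i) = i ∷ suc i ∷ []
changed n flip       = n ∷ []

involved : ℕ → Move → List ℕ
involved n (switch i) = filter (inRange? n) ((i ∸ 1) ∷ i ∷ suc i ∷ suc (suc i) ∷ [])
involved n flip       = filter (inRange? n) ((n ∸ 1) ∷ n ∷ [])

Disjoint : List ℕ → List ℕ → Set
Disjoint xs ys = ∀ k → k ∈ xs → k ∈ ys → ⊥

Commute : ℕ → Move → Move → Set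
Commute n m m' = Disjoint (changed n m) (involved n m') × Disjoint (changed n m') (involved n m)

sublists : {A : Set} → List A → List (List A)
sublists []      = [] ∷ []
sublists (x ∷ r) = sublists r ++ map (x ∷_) (sublists r)

applyAll : List Move → List Dir → List Dir
applyAll []      w = w
applyAll (m ∷ M) w = applyAll M (applyMove m w)

cubeVertices : List Dir → List Move → List (List Dir)
cubeVertices u M = map (λ S → applyAll S u) (sublists M)

-- presentations of d-cubes: a state u with d pairwise commuting moves
-- applicable at u
CubeData : ℕ → ℕ → Set
CubeData n d = Σ (State n) λ u → Σ (List Move) λ M →
  All (λ m → Applicable n m (proj₁ u)) M × AllPairs (Commute n) M × length M ≡ d

-- two presentations give the same cube iff they have the same vertex set
SameCube : ∀ {n d} → CubeData n d → CubeData n d → Set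
SameCube (u , M , _) (v , M' , _) =
  ∀ w → (w ∈ cubeVertices (proj₁ u) M → w ∈ cubeVertices (proj₁ v) M')
      × (w ∈ cubeVertices (proj₁ v) M' → w ∈ cubeVertices (proj₁ u) M)

CubeSetoid : ℕ → ℕ → Setoid 0ℓ 0ℓ
CubeSetoid n d = record
  { Carrier = CubeData n d
  ; _≈_ = SameCube
  ; isEquivalence = record
    { refl  = λ w → (λ x → x) , (λ x → x)
    ; sym   = λ p w → proj₂ (p w) , proj₁ (p w)
    ; trans = λ p q w → (λ x → proj₁ (q w) (proj₁ (p w) x)) , (λ x → proj₂ (p w) (proj₂ (q w) x))
    }
  }

-- A state of SR_n is determined by its shape, the list recording which links are vertical,
-- and the shapes that occur are exactly the spread-out ones; a corner switch swaps two
-- adjacent entries of the shape and an end flip toggles the last one.  Commuting moves act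
-- at least three links apart, so the vertices of the cube spanned at u by moves M are the
-- shapes obtained from u by independently reordering each switched pair and choosing the
-- last link when it is flipped.  Writing each switched pair as a square, a flipped last
-- link as a half-square and every other link as N or E therefore reads off a partial
-- F-path whose matching shapes are exactly these vertices (spread-out shapes correspond to
-- the F-condition); conversely a path spells out a base shape and commuting moves spanning
-- its cube.  As a path is determined by the shapes matching it, the two constructions are
-- mutually inverse.

module Submission where

open import Defs
open import Data.Nat using (ℕ; _≤_)
open import Function.Bundles using (Bijection)

open import Data.Nat using (zero; suc; _+_; _∸_; _<_; z≤n; s≤s)
import Data.Nat.Properties as ℕ
open import Data.Integer as ℤ using (ℤ; +≤+)
open import Data.Bool using (Bool; true; false; not; _∧_; if_then_else_)
open import Data.Bool.Properties using (¬-not; not-involutive; ∧-inverseʳ; ∧-zeroʳ; ∧-identityʳ)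
open import Data.List using (List; []; _∷_; length; map; filter; _++_)
import Data.List.Properties as List
open import Data.List.Relation.Unary.Any as Any using (here; there)
open import Data.List.Relation.Unary.All as All using (All; []; _∷_)
open import Data.List.Relation.Unary.AllPairs as AllPairs using (AllPairs; []; _∷_)
open import Data.List.Relation.Unary.Unique.Propositional using (Unique)
open import Data.List.Membership.Propositional using (_∈_; _∉_)
import Data.List.Membership.Propositional.Properties as ∈
open import Data.Maybe as Maybe using (just)
open import Data.Maybe.Properties using (just-injective)
open import Data.Product as Product using (∃; _×_; _,_; proj₁; proj₂)
open import Data.Sum as Sum using (_⊎_; inj₁; inj₂; [_,_]′)
open import Data.Unit using (⊤; tt)
open import Data.Empty using (⊥; ⊥-elim)
open import Function using (_∘_; _$_; case_of_)
open import Function.Bundles using (_⇔_; mk⇔; Equivalence)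
open import Relation.Nullary using (¬_; yes; no; does; contradiction)
import Relation.Nullary.Decidable as Dec
open import Relation.Nullary.Decidable using (toSum)
open import Relation.Binary.Definitions using (DecidableEquality)
open import Relation.Binary.PropositionalEquality

+-suc-suc : ∀ m n → m + suc (suc n) ≡ suc (suc (m + n))
+-suc-suc m n = trans (ℕ.+-suc m (suc n)) (cong suc (ℕ.+-suc m n))

map-sublists-∷ : ∀ {A B : Set} (g : List A → B) x xs →
                 map g (sublists (x ∷ xs)) ≡ map g (sublists xs) ++ map (g ∘ (x ∷_)) (sublists xs)
map-sublists-∷ g x xs = trans (List.map-++ g (sublists xs) (map (x ∷_) (sublists xs)))
                              (cong (map g (sublists xs) ++_) (sym (List.map-∘ (sublists xs))))

-- Shapes

-- Links are numbered from 1; `at s i` is false for i = 0 and past the end of s.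
at : List Bool → ℕ → Bool
at _       zero          = false
at []      (suc _)       = false
at (x ∷ _) (suc zero)    = x
at (_ ∷ s) (suc (suc i)) = at s (suc i)

SpreadOut : List Bool → Set
SpreadOut s = ∀ i → at s i ∧ at s (suc i) ≡ false

SpreadOut-[] : SpreadOut []
SpreadOut-[] zero    = refl
SpreadOut-[] (suc _) = refl

SpreadOut-∷ : ∀ {x s} → SpreadOut s → (x ≡ true → at s 1 ≡ false) → SpreadOut (x ∷ s)
SpreadOut-∷         _  _   zero          = refl
SpreadOut-∷ {false} _  _   (suc zero)    = refl
SpreadOut-∷ {true}  _  top (suc zero)    = top refl
SpreadOut-∷         so _   (suc (suc i)) = so (suc i)

SpreadOut-tail : ∀ {x s} → SpreadOut (x ∷ s) → SpreadOut s
SpreadOut-tail _  zero    = refl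
SpreadOut-tail so (suc i) = so (suc (suc i))

swap : {A : Set} → ℕ → List A → List A
swap (suc zero)    (x ∷ y ∷ r) = y ∷ x ∷ r
swap (suc (suc i)) (x ∷ r)     = x ∷ swap (suc i) r
swap _             s           = s

toggleLast : List Bool → List Bool
toggleLast []          = []
toggleLast (x ∷ [])    = not x ∷ []
toggleLast (x ∷ y ∷ r) = x ∷ toggleLast (y ∷ r)

length-swap : ∀ {A : Set} i (s : List A) → length (swap i s) ≡ length s
length-swap zero          s           = refl
length-swap (suc zero)    []          = refl
length-swap (suc zero)    (x ∷ [])    = refl
length-swap (suc zero)    (x ∷ y ∷ r) = refl
length-swap (suc (suc i)) []          = refl
length-swap (suc (suc i)) (x ∷ r)     = cong suc (length-swap (suc i) r)

swap-≢[] : ∀ {A : Set} i (x : A) s → swap i (x ∷ s) ≢ []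
swap-≢[] i x s eq with () ← trans (sym (length-swap i (x ∷ s))) (cong length eq)

length-toggleLast : ∀ s → length (toggleLast s) ≡ length s
length-toggleLast []          = refl
length-toggleLast (x ∷ [])    = refl
length-toggleLast (x ∷ y ∷ r) = cong suc (length-toggleLast (y ∷ r))

toggleLast-≢[] : ∀ x s → toggleLast (x ∷ s) ≢ []
toggleLast-≢[] x []      ()
toggleLast-≢[] x (_ ∷ _) ()

at-swap-left : ∀ i s → 1 ≤ i → i < length s → at (swap i s) i ≡ at s (suc i)
at-swap-left (suc zero)    (x ∷ y ∷ r) _ _         = refl
at-swap-left (suc zero)    (x ∷ [])    _ (s≤s ())
at-swap-left (suc (suc i)) (x ∷ r)     _ (s≤s i<) = at-swap-left (suc i) r (s≤s z≤n) i<

at-swap-right : ∀ i s → 1 ≤ i → i < length s → at (swap i s) (suc i) ≡ at s i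
at-swap-right (suc zero)    (x ∷ y ∷ r) _ _         = refl
at-swap-right (suc zero)    (x ∷ [])    _ (s≤s ())
at-swap-right (suc (suc i)) (x ∷ r)     _ (s≤s i<) = at-swap-right (suc i) r (s≤s z≤n) i<

at-swap-other : ∀ i s q → q ≢ i → q ≢ suc i → at (swap i s) q ≡ at s q
at-swap-other i s zero _ _ = refl
at-swap-other zero s (suc q) _ _ = refl
at-swap-other (suc zero) [] (suc q) _ _ = refl
at-swap-other (suc zero) (x ∷ []) (suc q) _ _ = refl
at-swap-other (suc zero) (x ∷ y ∷ r) (suc zero) q≢i _ = contradiction refl q≢i
at-swap-other (suc zero) (x ∷ y ∷ r) (suc (suc zero)) _ q≢1+i = contradiction refl q≢1+i
at-swap-other (suc zero) (x ∷ y ∷ r) (suc (suc (suc q))) _ _ = refl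
at-swap-other (suc (suc i)) [] (suc q) _ _ = refl
at-swap-other (suc (suc i)) (x ∷ r) (suc zero) _ _ = refl
at-swap-other (suc (suc i)) (x ∷ r) (suc (suc q)) q≢i q≢1+i =
  at-swap-other (suc i) r (suc q) (q≢i ∘ cong suc) (q≢1+i ∘ cong suc)

at-swap-far : ∀ i s q → suc i < q ⊎ q < i → at (swap i s) q ≡ at s q
at-swap-far i s q (inj₁ 1+i<q) = at-swap-other i s q (ℕ.>⇒≢ (ℕ.<-trans (ℕ.n<1+n i) 1+i<q)) (ℕ.>⇒≢ 1+i<q)
at-swap-far i s q (inj₂ q<i)   = at-swap-other i s q (ℕ.<⇒≢ q<i) (ℕ.<⇒≢ (ℕ.m<n⇒m<1+n q<i))

at-beyond : ∀ s q → length s ≤ q → at s (suc q) ≡ false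
at-beyond []      q       _        = refl
at-beyond (x ∷ s) (suc q) (s≤s s≤q) = at-beyond s q s≤q

at-toggleLast-last : ∀ x s → at (toggleLast (x ∷ s)) (length (x ∷ s)) ≡ not (at (x ∷ s) (length (x ∷ s)))
at-toggleLast-last x []      = refl
at-toggleLast-last x (y ∷ r) = at-toggleLast-last y r

at-toggleLast-other : ∀ s q → q ≢ length s → at (toggleLast s) q ≡ at s q
at-toggleLast-other []          q                   _ = refl
at-toggleLast-other (x ∷ [])    zero                _ = refl
at-toggleLast-other (x ∷ [])    (suc zero)          q≢1 = contradiction refl q≢1
at-toggleLast-other (x ∷ [])    (suc (suc q))       _ = refl
at-toggleLast-other (x ∷ y ∷ r) zero                _ = refl
at-toggleLast-other (x ∷ y ∷ r) (suc zero)          _ = refl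
at-toggleLast-other (x ∷ y ∷ r) (suc (suc q)) q≢len = at-toggleLast-other (y ∷ r) (suc q) (q≢len ∘ cong suc)

private
  n≢1+n : ∀ {n} → n ≢ suc n
  n≢1+n ()

  n≢2+n : ∀ {n} → n ≢ suc (suc n)
  n≢2+n ()

  1+n≢n : ∀ {n} → suc n ≢ n
  1+n≢n ()

  2+n≢n : ∀ {n} → suc (suc n) ≢ n
  2+n≢n ()

  ≢⇒∧≡false : ∀ {a b} → a ≢ b → b ∧ a ≡ false
  ≢⇒∧≡false {a} {b} a≢b = subst (λ c → b ∧ c ≡ false) (sym (¬-not a≢b)) (∧-inverseʳ b)

record Clearance (s : List Bool) (i : ℕ) : Set where
  field
    left  : at s (i ∸ 1) ∧ at s (suc i) ≡ false
    right : at s i ∧ at s (suc (suc i)) ≡ false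

swap-SpreadOut : ∀ i s → 1 ≤ i → i < length s → SpreadOut s →
                 at s i ≢ at s (suc i) → Clearance s i → SpreadOut (swap i s)
swap-SpreadOut i s 1≤i i< so differ clear q with q ℕ.≟ i | q ℕ.≟ suc i | suc q ℕ.≟ i
... | yes refl | _        | _        =
  trans (cong₂ _∧_ (at-swap-left i s 1≤i i<) (at-swap-right i s 1≤i i<)) (≢⇒∧≡false differ)
... | no _     | yes refl | _        =
  trans (cong₂ _∧_ (at-swap-right i s 1≤i i<) (at-swap-other i s (suc (suc i)) 2+n≢n 1+n≢n))
        (Clearance.right clear)
... | no _     | no _     | yes refl =
  trans (cong₂ _∧_ (at-swap-other (suc q) s q n≢1+n n≢2+n) (at-swap-left (suc q) s 1≤i i<))
        (Clearance.left clear)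
... | no q≢i   | no q≢1+i | no 1+q≢i =
  trans (cong₂ _∧_ (at-swap-other i s q q≢i q≢1+i)
                   (at-swap-other i s (suc q) 1+q≢i (λ eq → q≢i (ℕ.suc-injective eq))))
        (so q)

swap-SpreadOut⁻ : ∀ i s → 1 ≤ i → i < length s → SpreadOut (swap i s) → Clearance s i
swap-SpreadOut⁻ i s 1≤i i< so = record { left = left i 1≤i i< so ; right = right }
  where
    right : at s i ∧ at s (suc (suc i)) ≡ false
    right = trans (sym (cong₂ _∧_ (at-swap-right i s 1≤i i<) (at-swap-other i s (suc (suc i)) 2+n≢n 1+n≢n)))
                  (so (suc i))
    left : ∀ j → 1 ≤ j → j < length s → SpreadOut (swap j s) → at s (j ∸ 1) ∧ at s (suc j) ≡ false
    left (suc zero)    _   _  _  = refl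
    left (suc (suc j)) 1≤j j< so =
      trans (sym (cong₂ _∧_ (at-swap-other (suc (suc j)) s (suc j) n≢1+n n≢2+n)
                            (at-swap-left (suc (suc j)) s 1≤j j<)))
            (so (suc j))

FlipOK : ℕ → List Bool → Set
FlipOK n s = at s n ≡ false → at s (n ∸ 1) ≡ false

toggleLast-SpreadOut : ∀ s → SpreadOut s → FlipOK (length s) s → SpreadOut (toggleLast s)
toggleLast-SpreadOut []      _  _  = SpreadOut-[]
toggleLast-SpreadOut (x ∷ t) so ok q with q ℕ.≟ length (x ∷ t) | suc q ℕ.≟ length (x ∷ t)
... | yes refl | _        =
  trans (cong (at s′ q ∧_) (trans (at-toggleLast-other s (suc q) 1+n≢n) (at-beyond s q ℕ.≤-refl)))
        (∧-zeroʳ _)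
  where s = x ∷ t; s′ = toggleLast s
... | no _     | yes refl =
  trans (cong₂ _∧_ (at-toggleLast-other (x ∷ t) q n≢1+n) (at-toggleLast-last x t))
        (lastPair (at (x ∷ t) (suc q)) refl)
  where
    lastPair : ∀ b → at (x ∷ t) (suc q) ≡ b → at (x ∷ t) q ∧ not b ≡ false
    lastPair true  _   = ∧-zeroʳ _
    lastPair false eq  = cong (_∧ true) (ok eq)
... | no q≢n   | no 1+q≢n =
  trans (cong₂ _∧_ (at-toggleLast-other (x ∷ t) q q≢n) (at-toggleLast-other (x ∷ t) (suc q) 1+q≢n)) (so q)

toggleLast-SpreadOut⁻ : ∀ s → SpreadOut (toggleLast s) → FlipOK (length s) s
toggleLast-SpreadOut⁻ []      _  = λ eq → eq
toggleLast-SpreadOut⁻ (x ∷ t) so last≡false = begin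
  at s (length t)                                  ≡⟨ ∧-identityʳ _ ⟨
  at s (length t) ∧ true                           ≡⟨ cong (λ b → at s (length t) ∧ not b) last≡false ⟨
  at s (length t) ∧ not (at s (length s))          ≡⟨ cong₂ _∧_ (at-toggleLast-other s (length t) n≢1+n)
                                                                (at-toggleLast-last x t) ⟨
  at (toggleLast s) (length t) ∧ at (toggleLast s) (length s) ≡⟨ so (length t) ⟩
  false                                            ∎
  where
    open ≡-Reasoning
    s = x ∷ t

-- Moves on shapes

record SwitchOK (n : ℕ) (s : List Bool) (i : ℕ) : Set where
  field
    pos    : 1 ≤ i
    bound  : i < n
    differ : at s i ≢ at s (suc i)
    clear  : Clearance s i

ShapeMove : ℕ → List Bool → Move → Set
ShapeMove n s (switch i) = SwitchOK n s i
ShapeMove n s flip       = FlipOK n s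

applyShape : Move → List Bool → List Bool
applyShape (switch i) = swap i
applyShape flip       = toggleLast

Apart : ℕ → ℕ → Set
Apart a b = 3 + a ≤ b ⊎ 3 + b ≤ a

-- The list of which `involved n (switch a)` keeps the entries in 1 … n.
window : ℕ → List ℕ
window a = a ∸ 1 ∷ a ∷ suc a ∷ suc (suc a) ∷ []

window-bounds : ∀ {a k} → k ∈ window a → a ≤ suc k × k ≤ suc (suc a)
window-bounds {a} (here refl)                     = ℕ.m≤n+m∸n a 1 , ℕ.≤-trans (ℕ.m∸n≤m a 1) (ℕ.m≤n+m a 2)
window-bounds (there (here refl))                 = ℕ.n≤1+n _ , ℕ.m≤n+m _ 2
window-bounds (there (there (here refl)))         = ℕ.m≤n+m _ 2 , ℕ.n≤1+n _
window-bounds (there (there (there (here refl)))) = ℕ.m≤n+m _ 3 , ℕ.≤-refl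

private
  between : ∀ {a k} → a ≤ k → k ≤ suc (suc a) → k ∈ a ∷ suc a ∷ suc (suc a) ∷ []
  between {zero}  {zero}                   _   _                   = here refl
  between {zero}  {suc zero}               _   _                   = there (here refl)
  between {zero}  {suc (suc zero)}         _   _                   = there (there (here refl))
  between {zero}  {suc (suc (suc _))}      _   (s≤s (s≤s ()))
  between {suc a} {suc k} (s≤s a≤k) (s≤s k≤2+a) = ∈.∈-map⁺ suc (between a≤k k≤2+a)

  pair-bounds : ∀ {a k} → k ∈ a ∷ suc a ∷ [] → a ≤ k × k ≤ suc a
  pair-bounds (here refl)         = ℕ.≤-refl , ℕ.n≤1+n _
  pair-bounds (there (here refl)) = ℕ.n≤1+n _ , ℕ.≤-refl

  ∈-involved : ∀ {n xs k} → 1 ≤ k → k ≤ n → k ∈ xs → k ∈ filter (inRange? n) xs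
  ∈-involved 1≤k k≤n k∈ = ∈.∈-filter⁺ (inRange? _) k∈ (1≤k , k≤n)

  ∈-window : ∀ {a k} → a ≤ suc k → k ≤ suc (suc a) → k ∈ window a
  ∈-window {a} {k} a≤1+k k≤2+a with a ℕ.≤? k
  ... | yes a≤k = there (between a≤k k≤2+a)
  ... | no  a≰k = here (sym (cong (_∸ 1) (ℕ.≤-antisym a≤1+k (ℕ.≰⇒> a≰k))))

  ∈-lastPair : ∀ {n k} → n ≤ suc k → k ≤ n → k ∈ n ∸ 1 ∷ n ∷ []
  ∈-lastPair {n} {k} n≤1+k k≤n with n ℕ.≤? k
  ... | yes n≤k = there (here (ℕ.≤-antisym k≤n n≤k))
  ... | no  n≰k = here (sym (cong (_∸ 1) (ℕ.≤-antisym n≤1+k (ℕ.≰⇒> n≰k))))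

  lastPair-bound : ∀ {n k} → k ∈ n ∸ 1 ∷ n ∷ [] → n ≤ suc k
  lastPair-bound {n} (here refl)         = ℕ.m≤n+m∸n n 1
  lastPair-bound     (there (here refl)) = ℕ.n≤1+n _

commute-switch⇒Apart : ∀ {n i a} → 1 ≤ i → i < n → Commute n (switch i) (switch a) → Apart a i
commute-switch⇒Apart {i = i} {a} 1≤i i<n (disjoint , _) with 3 + a ℕ.≤? i | 3 + i ℕ.≤? a
... | yes a≪i | _       = inj₁ a≪i
... | no _    | yes i≪a = inj₂ i≪a
... | no ¬a≪i  | no ¬i≪a with a ℕ.≤? suc i
...   | yes a≤1+i = ⊥-elim $ disjoint i (here refl)
                      (∈-involved 1≤i (ℕ.<⇒≤ i<n) (∈-window a≤1+i (ℕ.≤-pred (ℕ.≰⇒> ¬a≪i))))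
...   | no  a≰1+i = ⊥-elim $ disjoint (suc i) (there (here refl))
                      (∈-involved (s≤s z≤n) i<n
                        (∈-window (ℕ.≤-pred (ℕ.≰⇒> ¬i≪a))
                                  (ℕ.m≤n⇒m≤o+n 2 (ℕ.<⇒≤ (ℕ.≰⇒> a≰1+i)))))

commute-flip⇒bound : ∀ {n i} → 1 ≤ i → i < n → Commute n (switch i) flip → 3 + i ≤ n
commute-flip⇒bound {n} {i} 1≤i i<n (disjoint , _) with 3 + i ℕ.≤? n
... | yes i≪n = i≪n
... | no  ¬i≪n = ⊥-elim (disjoint (suc i) (there (here refl))
                   (∈-involved (s≤s z≤n) i<n (∈-lastPair (ℕ.≤-pred (ℕ.≰⇒> ¬i≪n)) i<n)))

¬commute-flip-flip : ∀ {n} → 1 ≤ n → ¬ Commute n flip flip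
¬commute-flip-flip {n} 1≤n (disjoint , _) =
  disjoint n (here refl) (∈-involved {xs = n ∸ 1 ∷ n ∷ []} 1≤n ℕ.≤-refl (there (here refl)))

private
  ∈-involved⁻ : ∀ {n xs k} → k ∈ filter (inRange? n) xs → k ∈ xs
  ∈-involved⁻ = proj₁ ∘ ∈.∈-filter⁻ (inRange? _)

≪⇒commute-switch : ∀ {n a b} → 3 + a ≤ b → Commute n (switch a) (switch b)
≪⇒commute-switch {n} {a} {b} a≪b = disjointˡ , disjointʳ
  where
    disjointˡ : Disjoint (changed n (switch a)) (involved n (switch b))
    disjointˡ k k∈ k∈′ = ℕ.<⇒≱ a≪b
      (ℕ.≤-trans (proj₁ (window-bounds (∈-involved⁻ k∈′))) (s≤s (proj₂ (pair-bounds k∈))))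
    disjointʳ : Disjoint (changed n (switch b)) (involved n (switch a))
    disjointʳ k k∈ k∈′ = ℕ.<⇒≱ a≪b
      (ℕ.≤-trans (proj₁ (pair-bounds k∈)) (proj₂ (window-bounds (∈-involved⁻ k∈′))))

≪⇒commute-flip : ∀ {n a} → 3 + a ≤ n → Commute n (switch a) flip
≪⇒commute-flip {n} {a} a≪n = disjointˡ , disjointʳ
  where
    disjointˡ : Disjoint (changed n (switch a)) (involved n flip)
    disjointˡ k k∈ k∈′ = ℕ.<⇒≱ a≪n
      (ℕ.≤-trans (lastPair-bound (∈-involved⁻ k∈′)) (s≤s (proj₂ (pair-bounds k∈))))
    disjointʳ : Disjoint (changed n flip) (involved n (switch a))
    disjointʳ k (here refl) k∈′ = ℕ.<⇒≱ a≪n (proj₂ (window-bounds (∈-involved⁻ k∈′)))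

Apart-≤ : ∀ {a b} → Apart a b → a ≤ b → 3 + a ≤ b
Apart-≤ (inj₁ a≪b) _   = a≪b
Apart-≤ (inj₂ b≪a) a≤b = ⊥-elim (ℕ.1+n≰n (ℕ.≤-trans (ℕ.m≤n+m _ 2) (ℕ.≤-trans b≪a a≤b)))

Apart-sym : ∀ {a b} → Apart a b → Apart b a
Apart-sym (inj₁ a≪b) = inj₂ a≪b
Apart-sym (inj₂ b≪a) = inj₁ b≪a

Apart-near : ∀ {a b} → Apart a b → a ≤ b → b ≤ suc (suc a) → ⊥
Apart-near apart a≤b = ℕ.<⇒≱ (Apart-≤ apart a≤b)

SwitchOK-local : ∀ {n s s′ a} → (∀ {q} → q ∈ window a → at s′ q ≡ at s q) →
                 SwitchOK n s a → SwitchOK n s′ a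
SwitchOK-local same ok = record
  { pos    = pos
  ; bound  = bound
  ; differ = λ eq → differ (trans (sym (same (there (here refl)))) (trans eq (same (there (there (here refl))))))
  ; clear  = record
    { left  = trans (cong₂ _∧_ (same (here refl)) (same (there (there (here refl))))) left
    ; right = trans (cong₂ _∧_ (same (there (here refl))) (same (there (there (there (here refl)))))) right
    }
  }
  where open SwitchOK ok; open Clearance clear

swap-preserves : ∀ {n s i m} → SwitchOK n s i → Commute n (switch i) m → ShapeMove n s m →
                 ShapeMove n (swap i s) m
swap-preserves {s = s} {i} {switch a} ok c okₐ =
  SwitchOK-local (λ q∈ → at-swap-far i s _ (outside (commute-switch⇒Apart pos bound c) (window-bounds q∈))) okₐ
  where
    open SwitchOK ok
    outside : ∀ {q} → Apart a i → a ≤ suc q × q ≤ suc (suc a) → suc i < q ⊎ q < i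
    outside (inj₁ a≪i) (_ , q≤2+a)   = inj₂ (ℕ.≤-trans (s≤s q≤2+a) a≪i)
    outside (inj₂ i≪a) (a≤1+q , _)   = inj₁ (ℕ.≤-pred (ℕ.≤-trans i≪a a≤1+q))
swap-preserves {n} {s} {i} {flip} ok c flipOK last≡false =
  trans (at-swap-far i s (n ∸ 1) (inj₁ (ℕ.∸-monoˡ-≤ 1 i≪n)))
        (flipOK (trans (sym (at-swap-far i s n (inj₁ (ℕ.≤-trans (ℕ.n≤1+n _) i≪n)))) last≡false))
  where
    open SwitchOK ok
    i≪n = commute-flip⇒bound pos bound c

toggle-preserves : ∀ {n s m} → 1 ≤ n → length s ≡ n → Commute n flip m → ShapeMove n s m →
                   ShapeMove n (toggleLast s) m
toggle-preserves {s = s} {switch a} _ size c okₐ =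
  SwitchOK-local (λ {q} q∈ → at-toggleLast-other s q λ q≡len →
                    ℕ.<⇒≱ a≪n (subst (_≤ suc (suc a)) (trans q≡len size) (proj₂ (window-bounds q∈))))
                 okₐ
  where
    open SwitchOK okₐ
    a≪n = commute-flip⇒bound pos bound (Product.swap c)
toggle-preserves {m = flip} 1≤n _ c _ = ⊥-elim (¬commute-flip-flip 1≤n c)

-- The path read off a cube

switch-injective : ∀ {i j} → switch i ≡ switch j → i ≡ j
switch-injective refl = refl

_≟ₘ_ : DecidableEquality Move
switch i ≟ₘ switch j = Dec.map′ (cong switch) switch-injective (i ℕ.≟ j)
switch _ ≟ₘ flip     = no λ ()
flip     ≟ₘ switch _ = no λ ()
flip     ≟ₘ flip     = yes refl

open import Data.List.Membership.DecPropositional _≟ₘ_ using (_∈?_)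

edge : Bool → Link
edge true  = lN
edge false = lE

-- k is the index of the first link of s in the whole arm.
cubePath : ℕ → List Bool → List Move → List Link
cubePath k []          M = []
cubePath k (x ∷ [])    M = if does (flip ∈? M) then lHalf ∷ [] else edge x ∷ []
cubePath k (x ∷ y ∷ r) M =
  if does (switch k ∈? M) then lSq ∷ cubePath (suc (suc k)) r M
                           else edge x ∷ cubePath (suc k) (y ∷ r) M

cubePath-square : ∀ k x y r M → switch k ∈ M →
                  cubePath k (x ∷ y ∷ r) M ≡ lSq ∷ cubePath (suc (suc k)) r M
cubePath-square k x y r M k∈M with switch k ∈? M
... | yes _   = refl
... | no  k∉M = contradiction k∈M k∉M

cubePath-half : ∀ k x M → flip ∈ M → cubePath k (x ∷ []) M ≡ lHalf ∷ []
cubePath-half k x M f∈M with flip ∈? M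
... | yes _   = refl
... | no  f∉M = contradiction f∈M f∉M

cubePath-last : ∀ k x M → flip ∉ M → cubePath k (x ∷ []) M ≡ edge x ∷ []
cubePath-last k x M f∉M with flip ∈? M
... | yes f∈M = contradiction f∈M f∉M
... | no  _   = refl

cubePath-edge : ∀ k x t M → switch k ∉ M → (t ≡ [] → flip ∉ M) →
                cubePath k (x ∷ t) M ≡ edge x ∷ cubePath (suc k) t M
cubePath-edge k x []      M _   last = cubePath-last k x M (last refl)
cubePath-edge k x (_ ∷ _) M k∉M _ with switch k ∈? M
... | yes k∈M = contradiction k∈M k∉M
... | no  _   = refl

cubePath-switch-below : ∀ {a k} s M → a < k → cubePath k s (switch a ∷ M) ≡ cubePath k s M
cubePath-switch-below          []          M a<k = refl
cubePath-switch-below {a} {k} (x ∷ [])    M a<k =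
  [ (λ f∈M → trans (cubePath-half k x (switch a ∷ M) (there f∈M)) (sym (cubePath-half k x M f∈M)))
  , (λ f∉M → trans (cubePath-last k x (switch a ∷ M) (f∉M ∘ Any.tail λ ())) (sym (cubePath-last k x M f∉M)))
  ]′ (toSum (flip ∈? M))
cubePath-switch-below {a} {k} (x ∷ y ∷ r) M a<k =
  [ (λ k∈M → trans (cubePath-square k x y r (switch a ∷ M) (there k∈M))
                   (trans (cong (lSq ∷_) (cubePath-switch-below r M (ℕ.m<n⇒m<1+n (ℕ.m<n⇒m<1+n a<k))))
                          (sym (cubePath-square k x y r M k∈M))))
  , (λ k∉M → trans (cubePath-edge k x (y ∷ r) (switch a ∷ M) (k∉M ∘ Any.tail (a≢k ∘ switch-injective ∘ sym))
                                   (λ ()))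
                   (trans (cong (edge x ∷_) (cubePath-switch-below (y ∷ r) M (ℕ.m<n⇒m<1+n a<k)))
                          (sym (cubePath-edge k x (y ∷ r) M k∉M (λ ())))))
  ]′ (toSum (switch k ∈? M))
  where a≢k = ℕ.<⇒≢ a<k

-- Link j + 1 of s is link i of the arm.
record SquareSplit (k : ℕ) (s : List Bool) (M : List Move) (i j : ℕ) : Set where
  field
    prefix suffix : List Link
    switched   : cubePath k s (switch i ∷ M) ≡ prefix ++ lSq ∷ suffix
    unswitched : cubePath k s M ≡ prefix ++ edge (at s (suc j)) ∷ edge (at s (suc (suc j))) ∷ suffix
    swapped    : cubePath k (swap (suc j) s) M ≡
                 prefix ++ edge (at s (suc (suc j))) ∷ edge (at s (suc j)) ∷ suffix

squareSplit-here : ∀ k x y r M → switch k ∉ M → switch (suc k) ∉ M → (r ≡ [] → flip ∉ M) →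
                   SquareSplit k (x ∷ y ∷ r) M k 0
squareSplit-here k x y r M k∉M 1+k∉M last = record
  { prefix     = []
  ; suffix     = cubePath (suc (suc k)) r M
  ; switched   = trans (cubePath-square k x y r (switch k ∷ M) (here refl))
                       (cong (lSq ∷_) (cubePath-switch-below r M (ℕ.m<n⇒m<1+n (ℕ.n<1+n k))))
  ; unswitched = unfold x y
  ; swapped    = unfold y x
  }
  where
    unfold : ∀ a b → cubePath k (a ∷ b ∷ r) M ≡ edge a ∷ edge b ∷ cubePath (suc (suc k)) r M
    unfold a b = trans (cubePath-edge k a (b ∷ r) M k∉M (λ ()))
                       (cong (edge a ∷_) (cubePath-edge (suc k) b r M 1+k∉M last))

squareSplit-edge : ∀ {k x y r M i j} → switch k ∉ M → k ≢ i →
                   SquareSplit (suc k) (y ∷ r) M i j → SquareSplit k (x ∷ y ∷ r) M i (suc j)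
squareSplit-edge {k} {x} {y} {r} {M} {i} {j} k∉M k≢i split = record
  { prefix     = edge x ∷ prefix
  ; suffix     = suffix
  ; switched   = trans (cubePath-edge k x (y ∷ r) (switch i ∷ M) k∉iM (λ ())) (cong (edge x ∷_) switched)
  ; unswitched = trans (cubePath-edge k x (y ∷ r) M k∉M (λ ())) (cong (edge x ∷_) unswitched)
  ; swapped    = trans (cubePath-edge k x (swap (suc j) (y ∷ r)) M k∉M (⊥-elim ∘ swap-≢[] (suc j) y r))
                       (cong (edge x ∷_) swapped)
  }
  where
    open SquareSplit split
    k∉iM : switch k ∉ switch i ∷ M
    k∉iM = k∉M ∘ Any.tail (k≢i ∘ switch-injective)

squareSplit-square : ∀ {k x y r M i j} → switch k ∈ M → k ≢ i →
                     SquareSplit (suc (suc k)) r M i j → SquareSplit k (x ∷ y ∷ r) M i (suc (suc j))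
squareSplit-square {k} {x} {y} {r} {M} {i} {j} k∈M k≢i split = record
  { prefix     = lSq ∷ prefix
  ; suffix     = suffix
  ; switched   = trans (cubePath-square k x y r (switch i ∷ M) (there k∈M)) (cong (lSq ∷_) switched)
  ; unswitched = trans (cubePath-square k x y r M k∈M) (cong (lSq ∷_) unswitched)
  ; swapped    = trans (cubePath-square k x y (swap (suc j) r) M k∈M) (cong (lSq ∷_) swapped)
  }
  where open SquareSplit split

private
  4≰2 : ¬ (4 ≤ 2)
  4≰2 (s≤s (s≤s ()))

squareSplit : ∀ k j s M i → j + k ≡ i → suc j < length s →
              (∀ {a} → switch a ∈ M → Apart a i) → (flip ∈ M → 3 + suc j ≤ length s) →
              SquareSplit k s M i j
squareSplit k j       []          M i eq () apart flipFar
squareSplit k j       (x ∷ [])    M i eq (s≤s ()) apart flipFar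
squareSplit k zero    (x ∷ y ∷ r) M i refl _ apart flipFar =
  squareSplit-here k x y r M
    (λ k∈M → Apart-near (apart k∈M) ℕ.≤-refl (ℕ.m≤n+m k 2))
    (λ 1+k∈M → Apart-near (Apart-sym (apart 1+k∈M)) (ℕ.n≤1+n k) (ℕ.m≤n+m (suc k) 1))
    λ { refl f∈M → 4≰2 (flipFar f∈M) }
squareSplit k (suc j) (x ∷ y ∷ r) M i eq (s≤s j<) apart flipFar =
  [ (λ k∈M → square k∈M (ℕ.+-cancelʳ-≤ k 3 (suc j) (subst (3 + k ≤_) (sym eq) (Apart-≤ (apart k∈M) k≤i))))
  , (λ k∉M → squareSplit-edge k∉M k≢i
               (squareSplit (suc k) j (y ∷ r) M i (trans (ℕ.+-suc j k) eq) j< apart (ℕ.≤-pred ∘ flipFar)))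
  ]′ (toSum (switch k ∈? M))
  where
    k≤i : k ≤ i
    k≤i = subst (k ≤_) eq (ℕ.m≤n+m k (suc j))
    k≢i : k ≢ i
    k≢i k≡i = ℕ.m≢1+n+m k (trans k≡i (sym eq))
    square : switch k ∈ M → 3 ≤ suc j → SquareSplit k (x ∷ y ∷ r) M i (suc j)
    square k∈M (s≤s (s≤s (s≤s {n = j₂} z≤n))) =
      squareSplit-square k∈M k≢i
        (squareSplit (suc (suc k)) (suc j₂) r M i
          (trans (cong suc (+-suc-suc j₂ k)) eq)
          (ℕ.≤-pred j<) apart (ℕ.≤-pred ∘ ℕ.≤-pred ∘ flipFar))

record HalfSplit (k : ℕ) (s : List Bool) (M : List Move) : Set where
  field
    prefix    : List Link
    flipped   : cubePath k s (flip ∷ M) ≡ prefix ++ lHalf ∷ []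
    unflipped : cubePath k s M ≡ prefix ++ edge (at s (length s)) ∷ []
    toggled   : cubePath k (toggleLast s) M ≡ prefix ++ edge (not (at s (length s))) ∷ []

halfSplit-here : ∀ k x M → flip ∉ M → HalfSplit k (x ∷ []) M
halfSplit-here k x M f∉M = record
  { prefix    = []
  ; flipped   = cubePath-half k x (flip ∷ M) (here refl)
  ; unflipped = cubePath-last k x M f∉M
  ; toggled   = cubePath-last k (not x) M f∉M
  }

halfSplit-edge : ∀ {k x y r M} → switch k ∉ M → HalfSplit (suc k) (y ∷ r) M → HalfSplit k (x ∷ y ∷ r) M
halfSplit-edge {k} {x} {y} {r} {M} k∉M split = record
  { prefix    = edge x ∷ prefix
  ; flipped   = trans (cubePath-edge k x (y ∷ r) (flip ∷ M) (k∉M ∘ Any.tail λ ()) (λ ())) (cong (edge x ∷_) flipped)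
  ; unflipped = trans (cubePath-edge k x (y ∷ r) M k∉M (λ ())) (cong (edge x ∷_) unflipped)
  ; toggled   = trans (cubePath-edge k x (toggleLast (y ∷ r)) M k∉M (⊥-elim ∘ toggleLast-≢[] y r))
                      (cong (edge x ∷_) toggled)
  }
  where open HalfSplit split

halfSplit-square : ∀ {k x y z r M} → switch k ∈ M → HalfSplit (suc (suc k)) (z ∷ r) M →
                   HalfSplit k (x ∷ y ∷ z ∷ r) M
halfSplit-square {k} {x} {y} {z} {r} {M} k∈M split = record
  { prefix    = lSq ∷ prefix
  ; flipped   = trans (cubePath-square k x y (z ∷ r) (flip ∷ M) (there k∈M)) (cong (lSq ∷_) flipped)
  ; unflipped = trans (cubePath-square k x y (z ∷ r) M k∈M) (cong (lSq ∷_) unflipped)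
  ; toggled   = trans (cubePath-square k x y (toggleLast (z ∷ r)) M k∈M) (cong (lSq ∷_) toggled)
  }
  where open HalfSplit split

halfSplit : ∀ k x t M → flip ∉ M → (∀ {a} → switch a ∈ M → 3 + a < k + length (x ∷ t)) →
            HalfSplit k (x ∷ t) M
halfSplit k x []          M f∉M _    = halfSplit-here k x M f∉M
halfSplit k x (y ∷ r)     M f∉M near =
  [ square r near
  , (λ k∉M → halfSplit-edge k∉M
               (halfSplit (suc k) y r M f∉M (λ {a} a∈M → subst (3 + a <_) (ℕ.+-suc k _) (near a∈M))))
  ]′ (toSum (switch k ∈? M))
  where
    square : ∀ r → (∀ {a} → switch a ∈ M → 3 + a < k + length (x ∷ y ∷ r)) → switch k ∈ M →
             HalfSplit k (x ∷ y ∷ r) M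
    square []      near k∈M = ⊥-elim (4≰2 (ℕ.+-cancelˡ-≤ k 4 2 (subst (_≤ k + 2) (ℕ.+-comm 4 k) (near k∈M))))
    square (z ∷ r) near k∈M = halfSplit-square k∈M
      (halfSplit (suc (suc k)) z r M f∉M (λ {a} a∈M → subst (3 + a <_) (+-suc-suc k (length (z ∷ r))) (near a∈M)))

-- Vertices of a path

-- The shapes of the vertices of the cube whose path is p.
Matches : List Link → List Bool → Set
Matches []          []          = ⊤
Matches (lN ∷ p)    (true ∷ w)  = Matches p w
Matches (lE ∷ p)    (false ∷ w) = Matches p w
Matches (lSq ∷ p)   (a ∷ b ∷ w) = a ≡ not b × Matches p w
Matches (lHalf ∷ p) (_ ∷ w)     = Matches p w
Matches _           _           = ⊥

Matches-edge⁺ : ∀ x {p w} → Matches p w → Matches (edge x ∷ p) (x ∷ w)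
Matches-edge⁺ true  m = m
Matches-edge⁺ false m = m

Matches-edge⁻ : ∀ x {p w} → Matches (edge x ∷ p) w → ∃ λ w′ → w ≡ x ∷ w′ × Matches p w′
Matches-edge⁻ true  {w = true ∷ w}  m = w , refl , m
Matches-edge⁻ false {w = false ∷ w} m = w , refl , m

Matches-∷ : ∀ l {P Q} → (∀ {v} → Matches P v → Matches Q v) →
            ∀ {w} → Matches (l ∷ P) w → Matches (l ∷ Q) w
Matches-∷ lN    f {true ∷ _}      m       = f m
Matches-∷ lE    f {false ∷ _}     m       = f m
Matches-∷ lSq   f {_ ∷ _ ∷ _}     (e , m) = e , f m
Matches-∷ lHalf f {_ ∷ _}         m       = f m

Matches-∷-⊎ : ∀ l {P Q R} → (∀ {v} → Matches P v → Matches Q v ⊎ Matches R v) →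
              ∀ {w} → Matches (l ∷ P) w → Matches (l ∷ Q) w ⊎ Matches (l ∷ R) w
Matches-∷-⊎ lN    f {true ∷ _}  m       = f m
Matches-∷-⊎ lE    f {false ∷ _} m       = f m
Matches-∷-⊎ lSq   f {_ ∷ _ ∷ _} (e , m) = Sum.map (e ,_) (e ,_) (f m)
Matches-∷-⊎ lHalf f {_ ∷ _}     m       = f m

linkLen-edge : ∀ x → linkLen (edge x) ≡ 1
linkLen-edge true  = refl
linkLen-edge false = refl

isSquareish-edge : ∀ x → isSquareish (edge x) ≡ 0
isSquareish-edge true  = refl
isSquareish-edge false = refl

IsPartialNE-edge : ∀ x {p} → IsPartialNE (edge x ∷ p) → IsPartialNE p
IsPartialNE-edge true  ne = ne
IsPartialNE-edge false ne = ne

FollowOK-head : ∀ a {l X Y} → FollowOK a (l ∷ X) → FollowOK a (l ∷ Y)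
FollowOK-head lN    f = f
FollowOK-head lE    f = f
FollowOK-head lSq   f = f
FollowOK-head lHalf f = f

-- Of two opposite links one is N, which must be followed by E.
FollowOK-opposite : ∀ a x {X Y Z} → FollowOK a (edge x ∷ X) → FollowOK a (edge (not x) ∷ Y) → FollowOK a Z
FollowOK-opposite lN    true  () _
FollowOK-opposite lN    false _  ()
FollowOK-opposite lSq   true  () _
FollowOK-opposite lSq   false _  ()
FollowOK-opposite lE    _     _  _ = tt
FollowOK-opposite lHalf _     _  _ = tt

FollowOK-N⇒Sq : ∀ B → FollowOK lN B → FollowOK lSq B
FollowOK-N⇒Sq []      _   = tt
FollowOK-N⇒Sq (_ ∷ _) n→e = n→e

FollowOK-Sq⇒N : ∀ B → FollowOK lSq B → FollowOK lN B
FollowOK-Sq⇒N []      _   = tt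
FollowOK-Sq⇒N (_ ∷ _) s→e = s→e

-- P₁ and P₂ differ in one place, which P fuses into a square or half-square.
record Merge (P P₁ P₂ : List Link) : Set where
  field
    matches⁺  : ∀ {w} → Matches P₁ w ⊎ Matches P₂ w → Matches P w
    matches⁻  : ∀ {w} → Matches P w → Matches P₁ w ⊎ Matches P₂ w
    nonempty  : P₁ ≢ []
    partialNE : IsPartialNE P₁ → IsPartialNE P
    follow    : ∀ a → FollowOK a P₁ → FollowOK a P₂ → FollowOK a P
    fcond     : FCond P₁ → FCond P₂ → FCond P
    length≡   : pathLength P ≡ pathLength P₁
    squares≡  : squareCount P ≡ suc (squareCount P₁)

merge-square : ∀ x y B → x ≡ not y → Merge (lSq ∷ B) (edge x ∷ edge y ∷ B) (edge y ∷ edge x ∷ B)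
merge-square .(not y) y B refl = record
  { matches⁺  = [ square-of (not y) y refl , square-of y (not y) (sym (not-involutive y)) ]′
  ; matches⁻  = λ { {a ∷ b ∷ w} (refl , m) → split y b m }
  ; nonempty  = λ ()
  ; partialNE = IsPartialNE-edge y ∘ IsPartialNE-edge (not y)
  ; follow    = λ a f₁ f₂ → FollowOK-opposite a y f₂ f₁
  ; fcond     = fcond y
  ; length≡   = cong₂ (λ u v → u + (v + pathLength B)) (sym (linkLen-edge (not y))) (sym (linkLen-edge y))
  ; squares≡  = cong suc (cong₂ (λ u v → u + (v + squareCount B))
                                (sym (isSquareish-edge (not y))) (sym (isSquareish-edge y)))
  }
  where
    square-of : ∀ x z → x ≡ not z → ∀ {w} → Matches (edge x ∷ edge z ∷ B) w → Matches (lSq ∷ B) w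
    square-of x z x≡¬z m
      with _ , refl , m′ ← Matches-edge⁻ x m
      with _ , refl , m″ ← Matches-edge⁻ z m′ = x≡¬z , m″
    split : ∀ y b {w} → Matches B w → Matches (edge (not y) ∷ edge y ∷ B) (not b ∷ b ∷ w)
                                    ⊎ Matches (edge y ∷ edge (not y) ∷ B) (not b ∷ b ∷ w)
    split true  true  m = inj₁ m
    split true  false m = inj₂ m
    split false true  m = inj₂ m
    split false false m = inj₁ m
    fcond : ∀ y → FCond (edge (not y) ∷ edge y ∷ B) → FCond (edge y ∷ edge (not y) ∷ B) → FCond (lSq ∷ B)
    fcond true  (_ , n→e , c) _           = FollowOK-N⇒Sq B n→e , c
    fcond false _           (_ , n→e , c) = FollowOK-N⇒Sq B n→e , c

merge-half : ∀ x → Merge (lHalf ∷ []) (edge x ∷ []) (edge (not x) ∷ [])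
merge-half x = record
  { matches⁺  = [ half-of x , half-of (not x) ]′
  ; matches⁻  = λ { {b ∷ w} m → split x b m }
  ; nonempty  = λ ()
  ; partialNE = λ _ → tt
  ; follow    = λ a f₁ f₂ → FollowOK-opposite a x f₁ f₂
  ; fcond     = λ _ _ → tt , tt
  ; length≡   = cong (_+ 0) (sym (linkLen-edge x))
  ; squares≡  = cong suc (cong (_+ 0) (sym (isSquareish-edge x)))
  }
  where
    half-of : ∀ z {w} → Matches (edge z ∷ []) w → Matches (lHalf ∷ []) w
    half-of z m with _ , refl , m′ ← Matches-edge⁻ z m = m′
    split : ∀ x b {w} → Matches [] w → Matches (edge x ∷ []) (b ∷ w) ⊎ Matches (edge (not x) ∷ []) (b ∷ w)
    split true  true  m = inj₁ m
    split true  false m = inj₂ m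
    split false true  m = inj₂ m
    split false false m = inj₁ m

merge-∷ : ∀ l {P P₁ P₂} → Merge P P₁ P₂ → Merge (l ∷ P) (l ∷ P₁) (l ∷ P₂)
merge-∷ l {P} {P₁} merge = record
  { matches⁺  = [ Matches-∷ l (matches⁺ ∘ inj₁) , Matches-∷ l (matches⁺ ∘ inj₂) ]′
  ; matches⁻  = Matches-∷-⊎ l matches⁻
  ; nonempty  = λ ()
  ; partialNE = partialNE′ l
  ; follow    = λ a f₁ _ → FollowOK-head a f₁
  ; fcond     = λ (f₁ , c₁) (f₂ , c₂) → follow l f₁ f₂ , fcond c₁ c₂
  ; length≡   = cong (linkLen l +_) length≡
  ; squares≡  = trans (cong (isSquareish l +_) squares≡) (ℕ.+-suc (isSquareish l) _)
  }
  where
    open Merge merge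
    partialNE′ : ∀ l → IsPartialNE (l ∷ P₁) → IsPartialNE (l ∷ P)
    partialNE′ lN    = partialNE
    partialNE′ lE    = partialNE
    partialNE′ lSq   = partialNE
    partialNE′ lHalf = lastHalf P₁ nonempty
      where
        lastHalf : ∀ Q → Q ≢ [] → IsPartialNE (lHalf ∷ Q) → IsPartialNE (lHalf ∷ P)
        lastHalf []      Q≢[] = contradiction refl Q≢[]
        lastHalf (_ ∷ _) _    = λ ()

merge-++ : ∀ A {P P₁ P₂} → Merge P P₁ P₂ → Merge (A ++ P) (A ++ P₁) (A ++ P₂)
merge-++ []      merge = merge
merge-++ (l ∷ A) merge = merge-∷ l (merge-++ A merge)

-- Cubes of shapes

applyShapes : List Move → List Bool → List Bool
applyShapes []      s = s
applyShapes (m ∷ M) s = applyShapes M (applyShape m s)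

shapeCube : List Bool → List Move → List (List Bool)
shapeCube s M = map (λ S → applyShapes S s) (sublists M)

shapeCube-∷ : ∀ s m M → shapeCube s (m ∷ M) ≡ shapeCube s M ++ shapeCube (applyShape m s) M
shapeCube-∷ s m M = map-sublists-∷ (λ S → applyShapes S s) m M

record ShapeCube (n : ℕ) (s : List Bool) (M : List Move) : Set where
  field
    size      : length s ≡ n
    spread    : SpreadOut s
    movable   : All (ShapeMove n s) M
    commuting : AllPairs (Commute n) M

ShapeCube-tail : ∀ {n s m M} → ShapeCube n s (m ∷ M) → ShapeCube n s M
ShapeCube-tail cube = record
  { size = size ; spread = spread ; movable = All.tail movable ; commuting = AllPairs.tail commuting }
  where open ShapeCube cube

ShapeCube-move : ∀ {n s m M} → 1 ≤ n → ShapeCube n s (m ∷ M) → ShapeCube n (applyShape m s) M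
ShapeCube-move {s = s} {switch i} _ cube = record
  { size      = trans (length-swap i s) size
  ; spread    = swap-SpreadOut i s pos i<len spread differ clear
  ; movable   = All.zipWith (λ (c , ok′) → swap-preserves (All.head movable) c ok′)
                            (AllPairs.head commuting , All.tail movable)
  ; commuting = AllPairs.tail commuting
  }
  where
    open ShapeCube cube
    open SwitchOK (All.head movable)
    i<len = subst (i <_) (sym size) bound
ShapeCube-move {s = s} {flip} 1≤n cube = record
  { size      = trans (length-toggleLast s) size
  ; spread    = toggleLast-SpreadOut s spread (subst (λ k → FlipOK k s) (sym size) (All.head movable))
  ; movable   = All.zipWith (λ (c , ok) → toggle-preserves 1≤n size c ok)
                            (AllPairs.head commuting , All.tail movable)
  ; commuting = AllPairs.tail commuting
  }
  where open ShapeCube cube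

record Reading (n : ℕ) (s : List Bool) (M : List Move) (P : List Link) : Set where
  field
    sound    : ∀ {w} → w ∈ shapeCube s M → Matches P w
    complete : ∀ {w} → Matches P w → w ∈ shapeCube s M
    isFPath  : IsPartialFPath P
    length≡  : pathLength P ≡ n
    squares≡ : squareCount P ≡ length M

reading-∷ : ∀ {n s m M P P₁ P₂} → Merge P P₁ P₂ → Reading n s M P₁ → Reading n (applyShape m s) M P₂ →
            Reading n s (m ∷ M) P
reading-∷ {s = s} {m} {M} merge R₁ R₂ = record
  { sound    = λ w∈ → matches⁺ (Sum.map (sound R₁) (sound R₂)
                                   (∈.∈-++⁻ (shapeCube s M) (subst (_ ∈_) (shapeCube-∷ s m M) w∈)))
  ; complete = λ mP → subst (_ ∈_) (sym (shapeCube-∷ s m M))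
                        ([ ∈.∈-++⁺ˡ ∘ complete R₁ , ∈.∈-++⁺ʳ _ ∘ complete R₂ ]′ (matches⁻ mP))
  ; isFPath  = partialNE (proj₁ (isFPath R₁)) , fcond (proj₂ (isFPath R₁)) (proj₂ (isFPath R₂))
  ; length≡  = trans (Merge.length≡ merge) (length≡ R₁)
  ; squares≡ = trans (Merge.squares≡ merge) (cong suc (squares≡ R₁))
  }
  where
    open Merge merge using (matches⁺; matches⁻; partialNE; fcond)
    open Reading

cubePath-[] : ∀ k s → cubePath k s [] ≡ map edge s
cubePath-[] k []      = refl
cubePath-[] k (x ∷ t) = trans (cubePath-edge k x t [] (λ ()) (λ _ ())) (cong (edge x ∷_) (cubePath-[] (suc k) t))

Matches-edges : ∀ s → Matches (map edge s) s
Matches-edges []      = tt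
Matches-edges (x ∷ s) = Matches-edge⁺ x (Matches-edges s)

Matches-edges⁻ : ∀ s {w} → Matches (map edge s) w → w ≡ s
Matches-edges⁻ []      {[]} _ = refl
Matches-edges⁻ (x ∷ s) m with w′ , refl , m′ ← Matches-edge⁻ x m = cong (x ∷_) (Matches-edges⁻ s m′)

edges-IsPartialFPath : ∀ s → SpreadOut s → IsPartialFPath (map edge s)
edges-IsPartialFPath s so = partialNE s , fcond s so
  where
    partialNE : ∀ s → IsPartialNE (map edge s)
    partialNE []          = tt
    partialNE (true ∷ s)  = partialNE s
    partialNE (false ∷ s) = partialNE s
    fcond : ∀ s → SpreadOut s → FCond (map edge s)
    fcond []               _  = tt
    fcond (false ∷ s)      so = tt , fcond s (SpreadOut-tail so)
    fcond (true ∷ [])      _  = tt , tt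
    fcond (true ∷ y ∷ s)   so = horizontal y (so 1) , fcond (y ∷ s) (SpreadOut-tail so)
      where
        horizontal : ∀ y → y ≡ false → edge y ≡ lE
        horizontal false _ = refl

pathLength-edges : ∀ s → pathLength (map edge s) ≡ length s
pathLength-edges []      = refl
pathLength-edges (x ∷ s) = cong₂ _+_ (linkLen-edge x) (pathLength-edges s)

squareCount-edges : ∀ s → squareCount (map edge s) ≡ 0
squareCount-edges []      = refl
squareCount-edges (x ∷ s) = cong₂ _+_ (isSquareish-edge x) (squareCount-edges s)

edges-reading : ∀ {n s} → ShapeCube n s [] → Reading n s [] (map edge s)
edges-reading {s = s} cube = record
  { sound    = λ { (here refl) → Matches-edges s }
  ; complete = λ m → here (Matches-edges⁻ s m)
  ; isFPath  = edges-IsPartialFPath s (ShapeCube.spread cube)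
  ; length≡  = trans (pathLength-edges s) (ShapeCube.size cube)
  ; squares≡ = squareCount-edges s
  }

cubePath-reading : ∀ {n} → 1 ≤ n → ∀ s M → ShapeCube n s M → Reading n s M (cubePath 1 s M)
cubePath-reading 1≤n s [] cube = subst (Reading _ s []) (sym (cubePath-[] 1 s)) (edges-reading cube)
cubePath-reading 1≤n s (switch zero ∷ M) cube with () ← SwitchOK.pos (All.head (ShapeCube.movable cube))
cubePath-reading {n} 1≤n s (switch (suc j) ∷ M) cube =
  subst (Reading n s (switch (suc j) ∷ M)) (sym switched)
    (reading-∷ (merge-++ prefix (merge-square (at s (suc j)) (at s (suc (suc j))) suffix (¬-not differ)))
      (subst (Reading n s M) unswitched (cubePath-reading 1≤n s M (ShapeCube-tail cube)))
      (subst (Reading n (swap (suc j) s) M) swapped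
        (cubePath-reading 1≤n (swap (suc j) s) M (ShapeCube-move 1≤n cube))))
  where
    open ShapeCube cube
    open SwitchOK (All.head movable)
    apart : ∀ {a} → switch a ∈ M → Apart a (suc j)
    apart a∈M = commute-switch⇒Apart pos bound (All.lookup (AllPairs.head commuting) a∈M)
    flipFar : flip ∈ M → 3 + suc j ≤ length s
    flipFar f∈M = subst (3 + suc j ≤_) (sym size)
                    (commute-flip⇒bound pos bound (All.lookup (AllPairs.head commuting) f∈M))
    open SquareSplit (squareSplit 1 j s M (suc j) (ℕ.+-comm j 1) (subst (suc j <_) (sym size) bound) apart flipFar)
cubePath-reading 1≤n [] (flip ∷ M) cube with () ← subst (1 ≤_) (sym (ShapeCube.size cube)) 1≤n
cubePath-reading {n} 1≤n (x ∷ t) (flip ∷ M) cube =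
  subst (Reading n (x ∷ t) (flip ∷ M)) (sym flipped)
    (reading-∷ (merge-++ prefix (merge-half (at (x ∷ t) (length (x ∷ t)))))
      (subst (Reading n (x ∷ t) M) unflipped (cubePath-reading 1≤n (x ∷ t) M (ShapeCube-tail cube)))
      (subst (Reading n (toggleLast (x ∷ t)) M) toggled
        (cubePath-reading 1≤n (toggleLast (x ∷ t)) M (ShapeCube-move 1≤n cube))))
  where
    open ShapeCube cube
    f∉M : flip ∉ M
    f∉M f∈M = ¬commute-flip-flip 1≤n (All.lookup (AllPairs.head commuting) f∈M)
    near : ∀ {a} → switch a ∈ M → 3 + a < 1 + length (x ∷ t)
    near a∈M = s≤s (subst (_ ≤_) (sym size)
                 (commute-flip⇒bound pos bound (Product.swap (All.lookup (AllPairs.head commuting) a∈M))))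
      where open SwitchOK (All.lookup (All.tail movable) a∈M)
    open HalfSplit (halfSplit 1 x t M f∉M near)

-- The cube of a path

baseShape : List Link → List Bool
baseShape []          = []
baseShape (lN ∷ p)    = true ∷ baseShape p
baseShape (lE ∷ p)    = false ∷ baseShape p
baseShape (lSq ∷ p)   = true ∷ false ∷ baseShape p
baseShape (lHalf ∷ p) = false ∷ baseShape p

-- k is the index of the first link of p in the whole arm.
moves : ℕ → List Link → List Move
moves k []          = []
moves k (lN ∷ p)    = moves (suc k) p
moves k (lE ∷ p)    = moves (suc k) p
moves k (lSq ∷ p)   = switch k ∷ moves (suc (suc k)) p
moves k (lHalf ∷ p) = flip ∷ moves (suc k) p

length-baseShape : ∀ p → length (baseShape p) ≡ pathLength p
length-baseShape []          = refl
length-baseShape (lN ∷ p)    = cong suc (length-baseShape p)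
length-baseShape (lE ∷ p)    = cong suc (length-baseShape p)
length-baseShape (lSq ∷ p)   = cong (suc ∘ suc) (length-baseShape p)
length-baseShape (lHalf ∷ p) = cong suc (length-baseShape p)

length-moves : ∀ k p → length (moves k p) ≡ squareCount p
length-moves k []          = refl
length-moves k (lN ∷ p)    = length-moves (suc k) p
length-moves k (lE ∷ p)    = length-moves (suc k) p
length-moves k (lSq ∷ p)   = cong suc (length-moves (suc (suc k)) p)
length-moves k (lHalf ∷ p) = cong suc (length-moves (suc k) p)

baseShape-≢[] : ∀ l p → baseShape (l ∷ p) ≢ []
baseShape-≢[] lN    p ()
baseShape-≢[] lE    p ()
baseShape-≢[] lSq   p ()
baseShape-≢[] lHalf p ()

switch-∉-moves : ∀ {a} k p → a < k → switch a ∉ moves k p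
switch-∉-moves k []          a<k ()
switch-∉-moves k (lN ∷ p)    a<k = switch-∉-moves (suc k) p (ℕ.m<n⇒m<1+n a<k)
switch-∉-moves k (lE ∷ p)    a<k = switch-∉-moves (suc k) p (ℕ.m<n⇒m<1+n a<k)
switch-∉-moves k (lHalf ∷ p) a<k = switch-∉-moves (suc k) p (ℕ.m<n⇒m<1+n a<k) ∘ Any.tail (λ ())
switch-∉-moves k (lSq ∷ p)   a<k (here refl) = ℕ.<-irrefl refl a<k
switch-∉-moves k (lSq ∷ p)   a<k (there a∈)  =
  switch-∉-moves (suc (suc k)) p (ℕ.m<n⇒m<1+n (ℕ.m<n⇒m<1+n a<k)) a∈

cubePath-base : ∀ k p → IsPartialNE p → cubePath k (baseShape p) (moves k p) ≡ p
cubePath-base k []               _  = refl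
cubePath-base k (lN ∷ [])        _  = refl
cubePath-base k (lE ∷ [])        _  = refl
cubePath-base k (lHalf ∷ [])     _  = refl
cubePath-base k (lN ∷ l ∷ p)     ne =
  trans (cubePath-edge k true (baseShape (l ∷ p)) (moves (suc k) (l ∷ p))
          (switch-∉-moves (suc k) (l ∷ p) ℕ.≤-refl) (⊥-elim ∘ baseShape-≢[] l p))
        (cong (lN ∷_) (cubePath-base (suc k) (l ∷ p) ne))
cubePath-base k (lE ∷ l ∷ p)     ne =
  trans (cubePath-edge k false (baseShape (l ∷ p)) (moves (suc k) (l ∷ p))
          (switch-∉-moves (suc k) (l ∷ p) ℕ.≤-refl) (⊥-elim ∘ baseShape-≢[] l p))
        (cong (lE ∷_) (cubePath-base (suc k) (l ∷ p) ne))
cubePath-base k (lSq ∷ p)        ne =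
  trans (cubePath-square k true false (baseShape p) (moves k (lSq ∷ p)) (here refl))
        (cong (lSq ∷_)
          (trans (cubePath-switch-below (baseShape p) (moves (suc (suc k)) p) (ℕ.m<n⇒m<1+n (ℕ.n<1+n k)))
                 (cubePath-base (suc (suc k)) p ne)))

horizontal-after : ∀ p → FollowOK lN p → at (baseShape p) 1 ≡ false
horizontal-after []       _ = refl
horizontal-after (lE ∷ _) _ = refl

baseShape-SpreadOut : ∀ p → FCond p → SpreadOut (baseShape p)
baseShape-SpreadOut []          _        = SpreadOut-[]
baseShape-SpreadOut (lN ∷ p)    (f , fc) = SpreadOut-∷ (baseShape-SpreadOut p fc) (λ _ → horizontal-after p f)
baseShape-SpreadOut (lE ∷ p)    (_ , fc) = SpreadOut-∷ (baseShape-SpreadOut p fc) (λ ())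
baseShape-SpreadOut (lSq ∷ p)   (_ , fc) = SpreadOut-∷ (SpreadOut-∷ (baseShape-SpreadOut p fc) (λ ())) (λ _ → refl)
baseShape-SpreadOut (lHalf ∷ p) (_ , fc) = SpreadOut-∷ (baseShape-SpreadOut p fc) (λ ())

moves-movable : ∀ {n} s k p → IsPartialNE p → FCond p → 1 ≤ k → k + pathLength p ≡ suc n →
                (∀ q → at s (q + k) ≡ at (baseShape p) (suc q)) → (at s (k ∸ 1) ≡ true → FollowOK lN p) →
                All (ShapeMove n s) (moves k p)
moves-movable s k []           _  _        _   _     _       _      = []
moves-movable s k (lN ∷ p)     ne (f , fc) _   len   aligned _      =
  moves-movable s (suc k) p ne fc (s≤s z≤n) (trans (sym (ℕ.+-suc k _)) len)
    (λ q → trans (cong (at s) (ℕ.+-suc q k)) (aligned (suc q))) (λ _ → f)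
moves-movable s k (lE ∷ p)     ne (_ , fc) _   len   aligned _      =
  moves-movable s (suc k) p ne fc (s≤s z≤n) (trans (sym (ℕ.+-suc k _)) len)
    (λ q → trans (cong (at s) (ℕ.+-suc q k)) (aligned (suc q)))
    (λ vertical → contradiction (trans (sym (aligned 0)) vertical) λ ())
moves-movable s k (lHalf ∷ []) _  _        _   len   _       before =
  subst (λ k → FlipOK k s) (ℕ.suc-injective (trans (sym (ℕ.+-comm k 1)) len))
    (λ _ → ¬-not λ vertical → case before vertical of λ ()) ∷ []
moves-movable {n} s k (lSq ∷ p) ne (f , fc) 1≤k len  aligned _      = switchOK ∷
  moves-movable s (suc (suc k)) p ne fc (s≤s z≤n) (trans (sym (+-suc-suc k _)) len)
    (λ q → trans (cong (at s) (+-suc-suc q k)) (aligned (suc (suc q))))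
    (λ vertical → contradiction (trans (sym (aligned 1)) vertical) λ ())
  where
    switchOK : SwitchOK n s k
    switchOK = record
      { pos    = 1≤k
      ; bound  = ℕ.≤-pred (subst (suc (suc k) ≤_) len
                   (subst (_≤ k + pathLength (lSq ∷ p)) (ℕ.+-comm k 2) (ℕ.+-monoʳ-≤ k (s≤s (s≤s z≤n)))))
      ; differ = λ same → case trans (sym (aligned 0)) (trans same (aligned 1)) of λ ()
      ; clear  = record
        { left  = trans (cong (at s (k ∸ 1) ∧_) (aligned 1)) (∧-zeroʳ _)
        ; right = trans (cong₂ _∧_ (aligned 0) (aligned 2)) (horizontal-after p (FollowOK-Sq⇒N p f))
        }
      }

moves-commute-with : ∀ {n k} b p → IsPartialNE p → 3 + k ≤ b → b + pathLength p ≡ suc n →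
                     All (Commute n (switch k)) (moves b p)
moves-commute-with b []           _  _   _   = []
moves-commute-with b (lN ∷ p)     ne k≪b len =
  moves-commute-with (suc b) p ne (ℕ.m≤n⇒m≤1+n k≪b) (trans (sym (ℕ.+-suc b _)) len)
moves-commute-with b (lE ∷ p)     ne k≪b len =
  moves-commute-with (suc b) p ne (ℕ.m≤n⇒m≤1+n k≪b) (trans (sym (ℕ.+-suc b _)) len)
moves-commute-with b (lSq ∷ p)    ne k≪b len = ≪⇒commute-switch k≪b ∷
  moves-commute-with (suc (suc b)) p ne (ℕ.m≤n⇒m≤1+n (ℕ.m≤n⇒m≤1+n k≪b)) (trans (sym (+-suc-suc b _)) len)
moves-commute-with b (lHalf ∷ []) _  k≪b len =
  ≪⇒commute-flip (subst (_ ≤_) (ℕ.suc-injective (trans (sym (ℕ.+-comm b 1)) len)) k≪b) ∷ []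

moves-commute : ∀ {n} k p → IsPartialNE p → FCond p → k + pathLength p ≡ suc n →
                AllPairs (Commute n) (moves k p)
moves-commute k []           _  _        _   = []
moves-commute k (lN ∷ p)     ne (_ , fc) len = moves-commute (suc k) p ne fc (trans (sym (ℕ.+-suc k _)) len)
moves-commute k (lE ∷ p)     ne (_ , fc) len = moves-commute (suc k) p ne fc (trans (sym (ℕ.+-suc k _)) len)
moves-commute k (lHalf ∷ []) _  _        _   = [] ∷ []
moves-commute {n} k (lSq ∷ p) ne (f , fc) len =
  commute-with p ne f len′ ∷ moves-commute (suc (suc k)) p ne fc len′
  where
    len′ = trans (sym (+-suc-suc k _)) len
    commute-with : ∀ q → IsPartialNE q → FollowOK lSq q → suc (suc k) + pathLength q ≡ suc n →
                   All (Commute n (switch k)) (moves (suc (suc k)) q)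
    commute-with []       _  _ _   = []
    commute-with (lE ∷ q) ne′ _ len″ =
      moves-commute-with (suc (suc (suc k))) q ne′ ℕ.≤-refl
                         (trans (sym (ℕ.+-suc (suc (suc k)) (pathLength q))) len″)

baseCube : ∀ {n} p → IsPartialFPath p → pathLength p ≡ n → ShapeCube n (baseShape p) (moves 1 p)
baseCube p (ne , fc) len = record
  { size      = trans (length-baseShape p) len
  ; spread    = baseShape-SpreadOut p fc
  ; movable   = moves-movable (baseShape p) 1 p ne fc (s≤s z≤n) (cong suc len)
                  (λ q → cong (at (baseShape p)) (ℕ.+-comm q 1)) (λ ())
  ; commuting = moves-commute 1 p ne fc (cong suc len)
  }

oppositeShape : List Link → List Bool
oppositeShape []          = []
oppositeShape (lN ∷ p)    = true ∷ oppositeShape p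
oppositeShape (lE ∷ p)    = false ∷ oppositeShape p
oppositeShape (lSq ∷ p)   = false ∷ true ∷ oppositeShape p
oppositeShape (lHalf ∷ p) = true ∷ oppositeShape p

Matches-base : ∀ p → Matches p (baseShape p)
Matches-base []          = tt
Matches-base (lN ∷ p)    = Matches-base p
Matches-base (lE ∷ p)    = Matches-base p
Matches-base (lSq ∷ p)   = refl , Matches-base p
Matches-base (lHalf ∷ p) = Matches-base p

Matches-opposite : ∀ p → Matches p (oppositeShape p)
Matches-opposite []          = tt
Matches-opposite (lN ∷ p)    = Matches-opposite p
Matches-opposite (lE ∷ p)    = Matches-opposite p
Matches-opposite (lSq ∷ p)   = refl , Matches-opposite p
Matches-opposite (lHalf ∷ p) = Matches-opposite p

Matches-nonempty : ∀ l p → ¬ Matches (l ∷ p) []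
Matches-nonempty lN    p ()
Matches-nonempty lE    p ()
Matches-nonempty lSq   p ()
Matches-nonempty lHalf p ()

base-in : ∀ p q → (∀ w → Matches p w → Matches q w) → Matches q (baseShape p)
base-in p q p⊆q = p⊆q _ (Matches-base p)

opposite-in : ∀ p q → (∀ w → Matches p w → Matches q w) → Matches q (oppositeShape p)
opposite-in p q p⊆q = p⊆q _ (Matches-opposite p)

-- Two different first links are told apart by the base or the opposite shape of one of the paths.
matches-injective : ∀ p q → IsPartialNE p → IsPartialNE q →
                    (∀ w → Matches p w → Matches q w) → (∀ w → Matches q w → Matches p w) → p ≡ q
matches-injective []       []       _  _  _  _  = refl
matches-injective []       (b ∷ q)  _  _  p⊆q _   = ⊥-elim (Matches-nonempty b q (p⊆q [] tt))
matches-injective (a ∷ p)  []       _  _  _   q⊆p = ⊥-elim (Matches-nonempty a p (q⊆p [] tt))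
matches-injective (lN ∷ p) (lN ∷ q) ne ne′ p⊆q q⊆p =
  cong (lN ∷_) (matches-injective p q ne ne′ (p⊆q ∘ (true ∷_)) (q⊆p ∘ (true ∷_)))
matches-injective (lE ∷ p) (lE ∷ q) ne ne′ p⊆q q⊆p =
  cong (lE ∷_) (matches-injective p q ne ne′ (p⊆q ∘ (false ∷_)) (q⊆p ∘ (false ∷_)))
matches-injective (lSq ∷ p) (lSq ∷ q) ne ne′ p⊆q q⊆p =
  cong (lSq ∷_) (matches-injective p q ne ne′ (λ w m → proj₂ (p⊆q (true ∷ false ∷ w) (refl , m)))
                                              (λ w m → proj₂ (q⊆p (true ∷ false ∷ w) (refl , m))))
matches-injective (lHalf ∷ []) (lHalf ∷ []) _ _ _ _ = refl
matches-injective (lN ∷ p)  (lE ∷ q)    _ _ p⊆q _   = ⊥-elim (base-in (lN ∷ p) (lE ∷ q) p⊆q)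
matches-injective (lN ∷ p)  (lSq ∷ q)   _ _ _   q⊆p = ⊥-elim (opposite-in (lSq ∷ q) (lN ∷ p) q⊆p)
matches-injective (lN ∷ p)  (lHalf ∷ q) _ _ _   q⊆p = ⊥-elim (base-in (lHalf ∷ q) (lN ∷ p) q⊆p)
matches-injective (lE ∷ p)  (lN ∷ q)    _ _ p⊆q _   = ⊥-elim (base-in (lE ∷ p) (lN ∷ q) p⊆q)
matches-injective (lE ∷ p)  (lSq ∷ q)   _ _ _   q⊆p = ⊥-elim (base-in (lSq ∷ q) (lE ∷ p) q⊆p)
matches-injective (lE ∷ p)  (lHalf ∷ q) _ _ _   q⊆p = ⊥-elim (opposite-in (lHalf ∷ q) (lE ∷ p) q⊆p)
matches-injective (lSq ∷ p) (lN ∷ q)    _ _ p⊆q _   = ⊥-elim (opposite-in (lSq ∷ p) (lN ∷ q) p⊆q)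
matches-injective (lSq ∷ p) (lE ∷ q)    _ _ p⊆q _   = ⊥-elim (base-in (lSq ∷ p) (lE ∷ q) p⊆q)
matches-injective (lSq ∷ p) (lHalf ∷ []) _ _ p⊆q _  = ⊥-elim (base-in (lSq ∷ p) (lHalf ∷ []) p⊆q)
matches-injective (lHalf ∷ []) (lN ∷ q) _ _ p⊆q _   = ⊥-elim (base-in (lHalf ∷ []) (lN ∷ q) p⊆q)
matches-injective (lHalf ∷ []) (lE ∷ q) _ _ p⊆q _   = ⊥-elim (opposite-in (lHalf ∷ []) (lE ∷ q) p⊆q)
matches-injective (lHalf ∷ []) (lSq ∷ q) _ _ _ q⊆p  = ⊥-elim (base-in (lSq ∷ q) (lHalf ∷ []) q⊆p)

-- Configurations of the arm

-- The Bool records whether the arm is at height 1.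
height : Bool → ℤ
height false = ℤ.0ℤ
height true  = ℤ.1ℤ

linkDir : Bool → Bool → Dir
linkDir _     false = eas
linkDir false true  = nor
linkDir true  true  = sou

heightAfter : Bool → Bool → Bool
heightAfter b false = b
heightAfter b true  = not b

armFrom : Bool → List Bool → List Dir
armFrom b []      = []
armFrom b (x ∷ s) = linkDir b x ∷ armFrom (heightAfter b x) s

arm : List Bool → List Dir
arm = armFrom false

isVertical : Dir → Bool
isVertical eas = false
isVertical nor = true
isVertical sou = true

isVertical-linkDir : ∀ b x → isVertical (linkDir b x) ≡ x
isVertical-linkDir b     false = refl
isVertical-linkDir false true  = refl
isVertical-linkDir true  true  = refl

map-isVertical-armFrom : ∀ b s → map isVertical (armFrom b s) ≡ s
map-isVertical-armFrom b []      = refl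
map-isVertical-armFrom b (x ∷ s) = cong₂ _∷_ (isVertical-linkDir b x) (map-isVertical-armFrom (heightAfter b x) s)

armFrom-injective : ∀ b {s t} → armFrom b s ≡ armFrom b t → s ≡ t
armFrom-injective b {s} {t} eq =
  trans (sym (map-isVertical-armFrom b s)) (trans (cong (map isVertical) eq) (map-isVertical-armFrom b t))

length-armFrom : ∀ b s → length (armFrom b s) ≡ length s
length-armFrom b []      = refl
length-armFrom b (x ∷ s) = cong suc (length-armFrom (heightAfter b x) s)

swapAt-armFrom : ∀ i b s → SpreadOut s → swapAt i (armFrom b s) ≡ armFrom b (swap i s)
swapAt-armFrom zero          b s                     _  = refl
swapAt-armFrom (suc zero)    b []                    _  = refl
swapAt-armFrom (suc zero)    b (x ∷ [])              _  = refl
swapAt-armFrom (suc zero)    b (false ∷ false ∷ r)   _  = refl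
swapAt-armFrom (suc zero)    b (false ∷ true ∷ r)    _  = refl
swapAt-armFrom (suc zero)    b (true ∷ false ∷ r)    _  = refl
swapAt-armFrom (suc zero)    b (true ∷ true ∷ r)     so with () ← so 1
swapAt-armFrom (suc (suc i)) b []                    _  = refl
swapAt-armFrom (suc (suc i)) b (x ∷ r)               so =
  cong (linkDir b x ∷_) (swapAt-armFrom (suc i) (heightAfter b x) r (SpreadOut-tail so))

stepH-linkDir : ∀ b x → stepH (height b) (linkDir b x) ≡ height (heightAfter b x)
stepH-linkDir false false = refl
stepH-linkDir true  false = refl
stepH-linkDir false true  = refl
stepH-linkDir true  true  = refl

flipFrom-armFrom : ∀ b s → flipFrom (height b) (armFrom b s) ≡ armFrom b (toggleLast s)
flipFrom-armFrom b     []          = refl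
flipFrom-armFrom false (false ∷ []) = refl
flipFrom-armFrom true  (false ∷ []) = refl
flipFrom-armFrom false (true ∷ [])  = refl
flipFrom-armFrom true  (true ∷ [])  = refl
flipFrom-armFrom b     (x ∷ y ∷ r) = cong (linkDir b x ∷_)
  (trans (cong (λ h → flipFrom h (armFrom (heightAfter b x) (y ∷ r))) (stepH-linkDir b x))
         (flipFrom-armFrom (heightAfter b x) (y ∷ r)))

ValidFrom : ℕ × ℤ → List Dir → Set
ValidFrom p w = All InStrip (pointsFrom p w) × Unique (pointsFrom p w)

columns-from : ∀ x₀ x y w → x₀ ≤ x → All (λ p → x₀ ≤ proj₁ p) (pointsFrom (x , y) w)
columns-from x₀ x y []        x₀≤x = x₀≤x ∷ []
columns-from x₀ x y (nor ∷ w) x₀≤x = x₀≤x ∷ columns-from x₀ x _ w x₀≤x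
columns-from x₀ x y (sou ∷ w) x₀≤x = x₀≤x ∷ columns-from x₀ x _ w x₀≤x
columns-from x₀ x y (eas ∷ w) x₀≤x = x₀≤x ∷ columns-from x₀ (suc x) y w (ℕ.m≤n⇒m≤1+n x₀≤x)

left-behind : ∀ x y y′ w → All ((x , y) ≢_) (pointsFrom (suc x , y′) w)
left-behind x y y′ w = All.map (λ { x<x refl → ℕ.<-irrefl refl x<x }) (columns-from (suc x) (suc x) y′ w ℕ.≤-refl)

inStrip : ∀ x b → InStrip (x , height b)
inStrip x false = +≤+ z≤n , +≤+ z≤n
inStrip x true  = +≤+ z≤n , +≤+ (s≤s z≤n)

armFrom-ValidFrom : ∀ x b s → SpreadOut s → ValidFrom (x , height b) (armFrom b s)
armFrom-ValidFrom x b     []                _  = inStrip x b ∷ [] , [] ∷ []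
armFrom-ValidFrom x b     (false ∷ s)       so
  with strip , unique ← armFrom-ValidFrom (suc x) b s (SpreadOut-tail so) =
  inStrip x b ∷ strip , left-behind x _ _ (armFrom b s) ∷ unique
armFrom-ValidFrom x false (true ∷ [])       _  = inStrip x false ∷ inStrip x true ∷ [] , ((λ ()) ∷ []) ∷ [] ∷ []
armFrom-ValidFrom x true  (true ∷ [])       _  = inStrip x true ∷ inStrip x false ∷ [] , ((λ ()) ∷ []) ∷ [] ∷ []
armFrom-ValidFrom x b     (true ∷ true ∷ s) so with () ← so 1
armFrom-ValidFrom x false (true ∷ false ∷ s) so
  with strip , unique ← armFrom-ValidFrom x true (false ∷ s) (SpreadOut-tail so) =
  inStrip x false ∷ strip , ((λ ()) ∷ left-behind x _ _ (armFrom true s)) ∷ unique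
armFrom-ValidFrom x true  (true ∷ false ∷ s) so
  with strip , unique ← armFrom-ValidFrom x false (false ∷ s) (SpreadOut-tail so) =
  inStrip x true ∷ strip , ((λ ()) ∷ left-behind x _ _ (armFrom false s)) ∷ unique

private
  All-pointsFrom-head : ∀ {P : ℕ × ℤ → Set} {p} w → All P (pointsFrom p w) → P p
  All-pointsFrom-head []      (h ∷ _) = h
  All-pointsFrom-head (_ ∷ _) (h ∷ _) = h

  east-first : ∀ b s {w} → eas ∷ w ≡ armFrom b s → at s 1 ≡ false
  east-first b     (false ∷ s) _ = refl
  east-first false (true ∷ s)  ()
  east-first true  (true ∷ s)  ()

ValidFrom⇒armFrom : ∀ x b w → ValidFrom (x , height b) w → ∃ λ s → w ≡ armFrom b s × SpreadOut s
ValidFrom⇒armFrom x b     []              _ = [] , refl , SpreadOut-[]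
ValidFrom⇒armFrom x b     (eas ∷ w)       (_ ∷ strip , _ ∷ unique)
  with s , refl , so ← ValidFrom⇒armFrom (suc x) b w (strip , unique) =
  false ∷ s , refl , SpreadOut-∷ so (λ ())
ValidFrom⇒armFrom x false (nor ∷ [])      _ = true ∷ [] , refl , SpreadOut-∷ SpreadOut-[] (λ _ → refl)
ValidFrom⇒armFrom x false (nor ∷ eas ∷ w) (_ ∷ strip , _ ∷ unique)
  with s , eq , so ← ValidFrom⇒armFrom x true (eas ∷ w) (strip , unique) =
  true ∷ s , cong (nor ∷_) eq , SpreadOut-∷ so (λ _ → east-first true s eq)
ValidFrom⇒armFrom x false (nor ∷ nor ∷ w) (_ ∷ _ ∷ strip , _)
  with +≤+ (s≤s ()) ← proj₂ (All-pointsFrom-head w strip)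
ValidFrom⇒armFrom x false (nor ∷ sou ∷ w) (_ , (_ ∷ distinct) ∷ _) =
  ⊥-elim (All-pointsFrom-head w distinct refl)
ValidFrom⇒armFrom x false (sou ∷ w)       (_ ∷ strip , _)
  with () ← proj₁ (All-pointsFrom-head w strip)
ValidFrom⇒armFrom x true  (sou ∷ [])      _ = true ∷ [] , refl , SpreadOut-∷ SpreadOut-[] (λ _ → refl)
ValidFrom⇒armFrom x true  (sou ∷ eas ∷ w) (_ ∷ strip , _ ∷ unique)
  with s , eq , so ← ValidFrom⇒armFrom x false (eas ∷ w) (strip , unique) =
  true ∷ s , cong (sou ∷_) eq , SpreadOut-∷ so (λ _ → east-first false s eq)
ValidFrom⇒armFrom x true  (sou ∷ sou ∷ w) (_ ∷ _ ∷ strip , _)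
  with () ← proj₁ (All-pointsFrom-head w strip)
ValidFrom⇒armFrom x true  (sou ∷ nor ∷ w) (_ , (_ ∷ distinct) ∷ _) =
  ⊥-elim (All-pointsFrom-head w distinct refl)
ValidFrom⇒armFrom x true  (nor ∷ w)       (_ ∷ strip , _)
  with +≤+ (s≤s ()) ← proj₂ (All-pointsFrom-head w strip)

isVertical-linkAt : ∀ b s i → 1 ≤ i → i ≤ length s →
                    Maybe.map isVertical (linkAt i (armFrom b s)) ≡ just (at s i)
isVertical-linkAt b (x ∷ s) (suc zero)    _ _           = cong just (isVertical-linkDir b x)
isVertical-linkAt b (x ∷ s) (suc (suc i)) _ (s≤s i≤len) =
  isVertical-linkAt (heightAfter b x) s (suc i) (s≤s z≤n) i≤len

private
  isVertical≡false⇒eas : ∀ {d} → isVertical d ≡ false → d ≡ eas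
  isVertical≡false⇒eas {eas} _ = refl

  linkAt-horizontal : ∀ b s i → 1 ≤ i → i ≤ length s → at s i ≡ false → linkAt i (armFrom b s) ≡ just eas
  linkAt-horizontal b s i 1≤i i≤len at≡false with linkAt i (armFrom b s) | isVertical-linkAt b s i 1≤i i≤len
  ... | just d | eq = cong just (isVertical≡false⇒eas (trans (just-injective eq) at≡false))

Valid-arm⇒SpreadOut : ∀ s → Valid (arm s) → SpreadOut s
Valid-arm⇒SpreadOut s valid with s′ , eq , so ← ValidFrom⇒armFrom 0 false (arm s) valid =
  subst SpreadOut (sym (armFrom-injective false eq)) so

applicable⇒ShapeMove : ∀ {n s} m → length s ≡ n → SpreadOut s → Applicable n m (arm s) → ShapeMove n s m
applicable⇒ShapeMove {s = s} (switch i) size so (1≤i , i<n , links-differ , valid) = record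
  { pos    = 1≤i
  ; bound  = i<n
  ; differ = differ
  ; clear  = swap-SpreadOut⁻ i s 1≤i i<len
               (Valid-arm⇒SpreadOut (swap i s) (subst Valid (swapAt-armFrom i false s so) valid))
  }
  where
    i<len = subst (i <_) (sym size) i<n
    differ : at s i ≢ at s (suc i)
    differ same with at s i in eq
    ... | true  = case trans (sym (cong₂ _∧_ eq (sym same))) (so i) of λ ()
    ... | false = links-differ (trans (linkAt-horizontal false s i 1≤i (ℕ.<⇒≤ i<len) eq)
                                      (sym (linkAt-horizontal false s (suc i) (s≤s z≤n) i<len (sym same))))
applicable⇒ShapeMove {s = s} flip size so valid =
  subst (λ k → FlipOK k s) size
    (toggleLast-SpreadOut⁻ s (Valid-arm⇒SpreadOut (toggleLast s) (subst Valid (flipFrom-armFrom false s) valid)))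

ShapeMove⇒applicable : ∀ {n s} m → length s ≡ n → SpreadOut s → ShapeMove n s m → Applicable n m (arm s)
ShapeMove⇒applicable {s = s} (switch i) size so ok = pos , bound , links-differ , valid
  where
    open SwitchOK ok
    i<len = subst (i <_) (sym size) bound
    links-differ : linkAt i (arm s) ≢ linkAt (suc i) (arm s)
    links-differ eq = differ (just-injective
      (trans (sym (isVertical-linkAt false s i pos (ℕ.<⇒≤ i<len)))
             (trans (cong (Maybe.map isVertical) eq) (isVertical-linkAt false s (suc i) (s≤s z≤n) i<len))))
    valid : Valid (swapAt i (arm s))
    valid = subst Valid (sym (swapAt-armFrom i false s so))
              (armFrom-ValidFrom 0 false (swap i s) (swap-SpreadOut i s pos i<len so differ clear))
ShapeMove⇒applicable {s = s} flip size so ok =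
  subst Valid (sym (flipFrom-armFrom false s))
    (armFrom-ValidFrom 0 false (toggleLast s) (toggleLast-SpreadOut s so (subst (λ k → FlipOK k s) (sym size) ok)))

applyMove-arm : ∀ s m → SpreadOut s → applyMove m (arm s) ≡ arm (applyShape m s)
applyMove-arm s (switch i) so = swapAt-armFrom i false s so
applyMove-arm s flip       _  = flipFrom-armFrom false s

cubeVertices-arm : ∀ {n} → 1 ≤ n → ∀ s M → ShapeCube n s M → cubeVertices (arm s) M ≡ map arm (shapeCube s M)
cubeVertices-arm 1≤n s []      cube = refl
cubeVertices-arm 1≤n s (m ∷ M) cube = begin
  cubeVertices (arm s) (m ∷ M)
    ≡⟨ map-sublists-∷ (λ S → applyAll S (arm s)) m M ⟩
  cubeVertices (arm s) M ++ cubeVertices (applyMove m (arm s)) M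
    ≡⟨ cong₂ _++_ (cubeVertices-arm 1≤n s M (ShapeCube-tail cube))
                  (trans (cong (λ u → cubeVertices u M) (applyMove-arm s m (ShapeCube.spread cube)))
                         (cubeVertices-arm 1≤n (applyShape m s) M (ShapeCube-move 1≤n cube))) ⟩
  map arm (shapeCube s M) ++ map arm (shapeCube (applyShape m s) M)
    ≡⟨ List.map-++ arm (shapeCube s M) _ ⟨
  map arm (shapeCube s M ++ shapeCube (applyShape m s) M)
    ≡⟨ cong (map arm) (shapeCube-∷ s m M) ⟨
  map arm (shapeCube s (m ∷ M))
    ∎
  where open ≡-Reasoning

ArmMatches : List Link → List Dir → Set
ArmMatches P v = ∃ λ t → Matches P t × v ≡ arm t

cube-vertices : ∀ {n} → 1 ≤ n → ∀ s M → ShapeCube n s M →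
                ∀ v → v ∈ cubeVertices (arm s) M ⇔ ArmMatches (cubePath 1 s M) v
cube-vertices 1≤n s M cube v = mk⇔
  (λ v∈ → let t , t∈ , v≡ = ∈.∈-map⁻ arm (subst (v ∈_) vertices≡ v∈) in t , sound t∈ , v≡)
  (λ { (t , m , refl) → subst (arm t ∈_) (sym vertices≡) (∈.∈-map⁺ arm (complete m)) })
  where
    vertices≡ = cubeVertices-arm 1≤n s M cube
    open Reading (cubePath-reading 1≤n s M cube)

module _ (n d : ℕ) (1≤n : 1 ≤ n) where

  vertices : CubeData n d → List (List Dir)
  vertices ((u , _) , M , _) = cubeVertices u M

  sameCube : ∀ {c c′} P → (∀ v → v ∈ vertices c ⇔ ArmMatches P v) → (∀ v → v ∈ vertices c′ ⇔ ArmMatches P v) →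
             SameCube c c′
  sameCube P c≡ c′≡ v = from (c′≡ v) ∘ to (c≡ v) , from (c≡ v) ∘ to (c′≡ v)
    where open Equivalence

  pathCube : FPath n d → CubeData n d
  pathCube (p , fpath , len , squares) =
    (arm (baseShape p) , trans (length-armFrom false (baseShape p)) size ,
     armFrom-ValidFrom 0 false (baseShape p) spread) ,
    moves 1 p ,
    All.map (ShapeMove⇒applicable _ size spread) movable ,
    commuting ,
    trans (length-moves 1 p) squares
    where open ShapeCube (baseCube p fpath len)

  pathCube-vertices : ∀ x v → v ∈ vertices (pathCube x) ⇔ ArmMatches (proj₁ x) v
  pathCube-vertices (p , (ne , fc) , len , _) =
    subst (λ P → ∀ v → v ∈ cubeVertices (arm (baseShape p)) (moves 1 p) ⇔ ArmMatches P v) (cubePath-base 1 p ne)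
          (cube-vertices 1≤n (baseShape p) (moves 1 p) (baseCube p (ne , fc) len))

  matches-transfer : ∀ x y → (∀ v → v ∈ vertices (pathCube x) → v ∈ vertices (pathCube y)) →
                     ∀ t → Matches (proj₁ x) t → Matches (proj₁ y) t
  matches-transfer x y x⊆y t m
    with t′ , m′ , eq ← Equivalence.to (pathCube-vertices y (arm t))
                          (x⊆y (arm t) (Equivalence.from (pathCube-vertices x (arm t)) (t , m , refl))) =
    subst (Matches (proj₁ y)) (sym (armFrom-injective false eq)) m′

  pathCube-injective : ∀ {x y} → SameCube (pathCube x) (pathCube y) → proj₁ x ≡ proj₁ y
  pathCube-injective {x@(p , (ne , _) , _)} {y@(q , (ne′ , _) , _)} same =
    matches-injective p q ne ne′ (matches-transfer x y (proj₁ ∘ same)) (matches-transfer y x (proj₂ ∘ same))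

  pathCube-surjective : ∀ c → ∃ λ x → ∀ {z} → proj₁ z ≡ proj₁ x → SameCube (pathCube z) c
  pathCube-surjective ((w , size , valid) , M , applicable , commuting , dim)
    with s , refl , spread ← ValidFrom⇒armFrom 0 false w valid =
    x , λ {z} z≡x → sameCube {pathCube z} {(arm s , size , valid) , M , applicable , commuting , dim} P
                      (subst (λ Q → ∀ v → v ∈ vertices (pathCube z) ⇔ ArmMatches Q v) z≡x (pathCube-vertices z))
                      (cube-vertices 1≤n s M cube)
    where
      size′ = trans (sym (length-armFrom false s)) size
      cube : ShapeCube n s M
      cube = record
        { size      = size′
        ; spread    = spread
        ; movable   = All.map (applicable⇒ShapeMove _ size′ spread) applicable
        ; commuting = commuting
        }
      P = cubePath 1 s M
      open Reading (cubePath-reading 1≤n s M cube)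
      x : FPath n d
      x = P , isFPath , length≡ , trans squares≡ dim

  pathCube-bijection : Bijection (FPathSetoid n d) (CubeSetoid n d)
  pathCube-bijection = record
    { to        = pathCube
    ; cong      = λ { {p , _} {.p , _} refl v → (λ v∈ → v∈) , (λ v∈ → v∈) }
    ; bijective = (λ {x} {y} → pathCube-injective {x} {y}) , pathCube-surjective
    }

lemma5p8 : (n d : ℕ) → 1 ≤ n → Bijection (FPathSetoid n d) (CubeSetoid n d)
lemma5p8 = pathCube-bijection
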